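{- Let $\mathbf H$ be a finite atomic connected hypergraph. For all constructs $S,T$ of $\mathbf H$, the following are equivalent: $S\le^{\mathbf H}T$; $S\le_2^{\mathbf H}T$; $S\le_3^{\mathbf H}T$. That is, the three relations $\le$, $\le_2$, $\le_3$ coincide.
   Context: A hypergraph $\mathbf{H}$ on a finite set $H$ is a set $\mathbf{H}\subseteq\mathcal{P}(H)\setminus\{\emptyset\}$ with $\bigcup\mathbf{H}=H$; atomic means $\{x\}\in\mathbf{H}$ for all $x\in H$. For $X\subseteq H$, $\mathbf{H}_X=\{Z\in\mathbf{H}: Z\subseteq X\}$. $\mathbf{H}$ is connected if there is no partition $H=X_1\cup X_2$ into non-empty disjoint sets with $\mathbf{H}=\mathbf{H}_{X_1}\cup\mathbf{H}_{X_2}$. $\mathbf{H},X\leadsto H_1,\dots,H_n$ means that $H_1,\dots,H_n$ are the connected components of $\mathbf{H}_{H\setminus X}$, and $\mathbf{H}_i:=\mathbf{H}_{H_i}$. Constructs of connected $\mathbf H$ (rooted trees labelled by non-empty subsets of $H$): for non-empty $Y\subseteq H$, if $Y=H$ the one-node tree $H$ is a construct; if $Y\ne H$, $\mathbf H,Y\leadsto H_1,\dots,H_n$, and $T_i$ are constructs of $\mathbf H_i$, then $Y(T_1,\dots,T_n)$ (root $Y$, unordered subtrees $T_i$) is a construct. Convention: $\emptyset\{T_{i_0}\}$ (empty root label, single subtree) denotes $T_{i_0}$, and $Y\{T_i: i\in I\}$ denotes the construct with root $Y$ and subtrees $T_i$, $i\in I$. $\le^{\mathbf H}$: the smallest reflexive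 transitive relation such that (i) $Y(X(T_{11},\dots,T_{1m}),T_2,\dots,T_n)\le^{\mathbf H}(Y\cup X)(T_{11},\dots,T_{1m},T_2,\dots,T_n)$ whenever $\emptyset\ne Y\subsetneq H$, $\mathbf H,Y\leadsto K_1,\dots,K_n$, $\emptyset\neq X\subseteq K_1$, $\mathbf K_1,X\leadsto H_{11},\dots,H_{1m}$, $T_{1j}$ constructs of $\mathbf H_{1j}$, $T_i$ constructs of $\mathbf K_i$ ($i\ge2$); (ii) $Y(T_1,T_2,\dots,T_n)\le^{\mathbf H}Y(T_1',T_2,\dots,T_n)$ whenever $\mathbf H,Y\leadsto H_1,\dots,H_n$ and $T_1\le^{\mathbf H_1}T_1'$. $\le_2^{\mathbf H}$: the relation defined inductively by $H\le_2^{\mathbf H}H$, and $Y(S_1,\dots,S_m)\le_2^{\mathbf H}X(T_1,\dots,T_n)$ whenever $Y\subseteq X$, $\mathbf H,Y\leadsto K_1,\dots,K_m$, $\mathbf H,X\leadsto H_1,\dots,H_n$, $S_j$ constructs of $\mathbf K_j$, $T_i$ constructs of $\mathbf H_i$, and $S_j\le_2^{\mathbf K_j}(K_j\cap X)\{T_i: H_i\subseteq K_j\}$ for all $j$. Partial constructs of connected $\mathbf H$: the one-node tree $\Omega_H$ is one; the one-node tree $H$ is one; and if $X\subseteq H$ non-empty, $\mathbf H,X\leadsto H_1,\dots,H_n$ and $\mathbb T_i$ are partial constructs of $\mathbf H_i$, then $X(\mathbb T_1,\dots,\mathbb T_n)$ is one. A partial construct $\mathbb T$ spans $X$ (written $\mathbb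 T\blacktriangleright^{\mathbf H}X$) if $X$ is the union of its labels other than the $\Omega$-labels. In such a case (with $\mathbf H,X\leadsto H_1,\dots,H_n$) the $\Omega$-leaves of $\mathbb T$ are exactly one occurrence of each $\Omega_{H_i}$; $\mathbb T[\dots,\Omega_{H_i}\leftarrow S_i,\dots]$ denotes the result of replacing each $\Omega_{H_i}$ by $S_i$. $\le_3^{\mathbf H}$: defined inductively by $S\le_3^{\mathbf H}H$ for every construct $S$ of $\mathbf H$, and $\mathbb T[\dots,\Omega_{H_i}\leftarrow S_i,\dots]\le_3^{\mathbf H}X(T_1,\dots,T_n)$ whenever $X$ is non-empty, $\mathbb T\blacktriangleright^{\mathbf H}X$, $\mathbf H,X\leadsto H_1,\dots,H_n$, $S_i,T_i$ constructs of $\mathbf H_i$ and $S_i\le_3^{\mathbf H_i}T_i$ for all $i$. -}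

module Defs where

open import Data.Nat using (ℕ)
open import Data.Bool using (Bool; true; false; _∧_)
open import Data.Fin using (Fin)
open import Data.Fin.Subset using (Subset; _∈_; _⊆_; _∪_; _∩_; _─_; ⁅_⁆; ⊥; Nonempty; Empty)
open import Data.Fin.Subset.Properties using (_⊆?_; nonempty?)
open import Data.List using (List; []; _∷_; _++_; zip)
open import Data.List.Membership.Propositional using () renaming (_∈_ to _∈L_)
open import Data.List.Relation.Unary.Unique.Propositional using (Unique)
open import Data.List.Relation.Binary.Pointwise using (Pointwise)
open import Data.List.Relation.Binary.Permutation.Propositional using (_↭_)
open import Data.Product using (Σ; ∃; ∃-syntax; _×_; _,_; proj₁; proj₂)
open import Data.Sum using (_⊎_)
open import Relation.Nullary using (¬_; does; yes; no)
open import Relation.Binary.PropositionalEquality using (_≡_; _≢_)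
open import Function.Bundles using (_⇔_)

private variable n : ℕ

-- Hypergraphs on (subsets of) the finite set Fin n.
-- V is the vertex set H, E the characteristic function of the set of
-- hyperedges 𝐇 ⊆ 𝒫(H).

record Hyp (n : ℕ) : Set where
  constructor hyp
  field
    V : Subset n
    E : Subset n → Bool
open Hyp public

Edge : Hyp n → Subset n → Set
Edge H Z = E H Z ≡ true

IsHypergraph : Hyp n → Set
IsHypergraph {n} H =
  (∀ Z → Edge H Z → Nonempty Z) ×
  (∀ Z → Edge H Z → Z ⊆ V H) ×
  (∀ (x : Fin n) → x ∈ V H → ∃[ Z ] (Edge H Z × x ∈ Z))

Atomic : Hyp n → Set
Atomic {n} H = ∀ (x : Fin n) → x ∈ V H → Edge H ⁅ x ⁆

restrict : Hyp n → Subset n → Hyp n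
restrict H X = hyp X (λ Z → E H Z ∧ does (Z ⊆? X))

Disjoint : Subset n → Subset n → Set
Disjoint p q = p ∩ q ≡ ⊥

Connected : Hyp n → Set
Connected H = ¬ (Σ _ λ X₁ → Σ _ λ X₂ →
  Nonempty X₁ × Nonempty X₂ × Disjoint X₁ X₂ × (X₁ ∪ X₂ ≡ V H) ×
  (∀ Z → Edge H Z → (Z ⊆ X₁) ⊎ (Z ⊆ X₂)))

IsComponent : Hyp n → Subset n → Set
IsComponent G K =
  Nonempty K × K ⊆ V G × Connected (restrict G K) ×
  (∀ K′ → K ⊆ K′ → K′ ⊆ V G → Connected (restrict G K′) → K′ ≡ K)

Components : Hyp n → List (Subset n) → Set
Components G Ks = Unique Ks × (∀ K → (K ∈L Ks) ⇔ IsComponent G K)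

-- 𝐇 , Y ⇝ H₁ , … , Hₙ
Leads : Hyp n → Subset n → List (Subset n) → Set
Leads H Y Ks = Components (restrict H (V H ─ Y)) Ks

-- Rooted trees labelled by subsets; children are a list, considered up to
-- permutation (see _≈T_).

data Tree (n : ℕ) : Set where
  node : Subset n → List (Tree n) → Tree n

data _≈T_ {n} : Tree n → Tree n → Set where
  node≈ : ∀ {Y ss us ts} → ss ↭ us → Pointwise _≈T_ us ts → node Y ss ≈T node Y ts

data Construct {n} : Hyp n → Tree n → Set where
  whole : ∀ {H} → Nonempty (V H) → Construct H (node (V H) [])
  root  : ∀ {H Y Ks Ts} → Nonempty Y → Y ⊆ V H → Y ≢ V H → Leads H Y Ks →
          Pointwise (λ K T → Construct (restrict H K) T) Ks Ts →
          Construct H (node Y Ts)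

data _≤[_]_ {n} : Tree n → Hyp n → Tree n → Set where
  refl≤  : ∀ {H S T} → Construct H S → S ≈T T → S ≤[ H ] T
  trans≤ : ∀ {H S T U} → S ≤[ H ] T → T ≤[ H ] U → S ≤[ H ] U
  merge  : ∀ {H Y K₁ Ks X H₁s T₁s Ts} →
           Nonempty Y → Y ⊆ V H → Y ≢ V H → Leads H Y (K₁ ∷ Ks) →
           Nonempty X → X ⊆ K₁ → Leads (restrict H K₁) X H₁s →
           Pointwise (λ K T → Construct (restrict (restrict H K₁) K) T) H₁s T₁s →
           Pointwise (λ K T → Construct (restrict H K) T) Ks Ts →
           node Y (node X T₁s ∷ Ts) ≤[ H ] node (Y ∪ X) (T₁s ++ Ts)
  cong≤  : ∀ {H Y K₁ Ks T₁ T₁′ Ts} →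
           Nonempty Y → Y ⊆ V H → Y ≢ V H → Leads H Y (K₁ ∷ Ks) →
           Pointwise (λ K T → Construct (restrict H K) T) Ks Ts →
           T₁ ≤[ restrict H K₁ ] T₁′ →
           node Y (T₁ ∷ Ts) ≤[ H ] node Y (T₁′ ∷ Ts)

-- L{T_i : i ∈ I}, with the convention ∅{T} = T
brace : Subset n → List (Tree n) → Tree n
brace L (t ∷ []) with nonempty? L
... | yes _ = node L (t ∷ [])
... | no  _ = t
brace L ts = node L ts

select : Subset n → List (Subset n × Tree n) → List (Tree n)
select K [] = []
select K ((Hᵢ , Tᵢ) ∷ ps) with Hᵢ ⊆? K
... | yes _ = Tᵢ ∷ select K ps
... | no  _ = select K ps

data _≤₂[_]_ {n} : Tree n → Hyp n → Tree n → Set where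
  base₂ : ∀ {H} → node (V H) [] ≤₂[ H ] node (V H) []
  step₂ : ∀ {H Y X Ks Hs Ss Ts} →
          Nonempty Y → Nonempty X → Y ⊆ X → X ⊆ V H →
          Leads H Y Ks → Leads H X Hs →
          Pointwise (λ K S → Construct (restrict H K) S) Ks Ss →
          Pointwise (λ K T → Construct (restrict H K) T) Hs Ts →
          Pointwise (λ K S → S ≤₂[ restrict H K ] brace (K ∩ X) (select K (zip Hs Ts))) Ks Ss →
          node Y Ss ≤₂[ H ] node X Ts

data PTree (n : ℕ) : Set where
  Ω     : Subset n → PTree n
  pnode : Subset n → List (PTree n) → PTree n

data PartialConstruct {n} : Hyp n → PTree n → Set where
  pΩ     : ∀ {H} → PartialConstruct H (Ω (V H))
  pwhole : ∀ {H} → PartialConstruct H (pnode (V H) [])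
  proot  : ∀ {H X Hs Ps} → Nonempty X → X ⊆ V H → Leads H X Hs →
           Pointwise (λ K P → PartialConstruct (restrict H K) P) Hs Ps →
           PartialConstruct H (pnode X Ps)

mutual
  labels : PTree n → Subset n
  labels (Ω _)       = ⊥
  labels (pnode X ps) = X ∪ labelsL ps

  labelsL : List (PTree n) → Subset n
  labelsL []       = ⊥
  labelsL (p ∷ ps) = labels p ∪ labelsL ps

Spans : Hyp n → PTree n → Subset n → Set
Spans H P X = PartialConstruct H P × labels P ≡ X

-- Fill σ 𝕋 S : S = 𝕋[…, Ω_{K} ← S_K, …] where σ lists the pairs (K , S_K)
data Fill {n} (σ : List (Subset n × Tree n)) : PTree n → Tree n → Set where
  fillΩ    : ∀ {K S} → (K , S) ∈L σ → Fill σ (Ω K) S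
  fillNode : ∀ {X ps ts} → Pointwise (Fill σ) ps ts → Fill σ (pnode X ps) (node X ts)

data _≤₃[_]_ {n} : Tree n → Hyp n → Tree n → Set where
  base₃ : ∀ {H S} → Construct H S → S ≤₃[ H ] node (V H) []
  step₃ : ∀ {H X P Hs Ss Ts R} →
          Nonempty X → Spans H P X → Leads H X Hs →
          Pointwise (λ K S → Construct (restrict H K) S) Hs Ss →
          Pointwise (λ K T → Construct (restrict H K) T) Hs Ts →
          Pointwise (λ K ST → proj₁ ST ≤₃[ restrict H K ] proj₂ ST) Hs (zip Ss Ts) →
          Fill (zip Hs Ss) P R →
          R ≤₃[ H ] node X Ts

--  * ≤ ⊆ ≤₂ (≤⇒≤₂): ≤₂ is reflexive, even across reorderings of children,
--    transitive, and contains both generators of ≤ (merging a child into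
--    the root; congruence at a child).  Transitivity rests on ≤₂-restrict:
--    for Z ⊆ Y ⊆ X, a ≤₂-step Y(…) ≤₂ X(…) restricts to every component of
--    𝐇 ∖ Z, comparing the targets with respect to Y and to X.
--  * ≤₂ ⊆ ≤₃ (≤₂⇒≤₃): by induction on the derivation, S ≤₂ X(T₁,…,Tₙ) yields
--    a Decomposition of S: a partial construct spanning X together with a
--    substitution for its Ω-leaves whose entries are ≤₃ the matching Tᵢ.
--    This is exactly the data of a ≤₃-step.
--  * ≤₃ ⊆ ≤ (≤₃⇒≤): a filled partial construct spanning X is ≤ X(T₁,…,Tₙ):
--    improve every child of its root to its target by congruence, then
--    absorb the children into the root one at a time (Collapse.collapse).
--    The same collapse shows that every construct is ≤ the one-node H.

module Submission where

open import Defs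
open import Data.Nat using (ℕ)
open import Data.Bool using (true; false; _∧_)
open import Data.Bool.Properties using () renaming (_≟_ to _≟ᴮ_)
open import Data.Fin using (Fin)
open import Data.Fin.Subset using (Subset; _∈_; _∉_; _⊆_; _∪_; _∩_; _─_; ⁅_⁆; ⊥; Nonempty; _⊂_; _⊃_)
open import Data.Fin.Subset.Properties
  using (x∈p∪q⁻; x∈p∩q⁻; x∈p∩q⁺; p⊆p∪q; q⊆p∪q; x∈p∧x∉q⇒x∈p─q; p─q⊆p; p∩q⊆p; p∩q⊆q; ⊆-antisym; Empty-unique; ∉⊥;
         nonempty?; _⊆?_; _∈?_; _⊂?_; anySubset?; x∈⁅y⁆⇒x≡y; x∈⁅x⁆; ∪-identityʳ)
open import Data.Fin.Subset.Induction using (⊂-wellFounded; ⊃-wellFounded)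
open import Data.Vec.Properties using (≡-dec)
open import Data.Vec.Base using (here; there; _∷_)
open import Data.List using (List; []; _∷_; _++_; zip; map)
open import Data.List.Properties using (++-identityʳ; map-++; ++-assoc)
open import Data.List.Membership.Propositional using (find; lose) renaming (_∈_ to _∈L_)
open import Data.List.Membership.Propositional.Properties using (∈-++⁺ˡ; ∈-++⁺ʳ; ∈-++⁻; ∈-map⁺; ∈-map⁻; ∈-∃++)
open import Data.List.Membership.Propositional.Properties.WithK using (unique∧set⇒bag)
open import Data.List.Relation.Binary.BagAndSetEquality using (∼bag⇒↭)
open import Data.List.Relation.Unary.Any as Any using (Any; here; there)
open import Data.List.Relation.Unary.All using (All; []; _∷_)
open import Data.List.Relation.Unary.AllPairs using ([]; _∷_)
open import Data.List.Relation.Unary.Unique.Propositional using (Unique)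
import Data.List.Relation.Unary.Unique.Propositional.Properties as UP
open import Data.List.Relation.Binary.Pointwise using (Pointwise; []; _∷_)
import Data.List.Relation.Binary.Pointwise as PW
open import Data.List.Relation.Binary.Permutation.Propositional using (_↭_; refl; prep; swap; trans; ↭-sym)
open import Data.List.Relation.Binary.Permutation.Propositional.Properties using (All-resp-↭; ∈-resp-↭; ↭-empty-inv; shift)
import Data.List.Relation.Binary.Permutation.Propositional.Properties as PermP
open import Data.Product using (Σ; _×_; _,_; proj₁; proj₂)
open import Data.Sum using (_⊎_; inj₁; inj₂; [_,_])
open import Data.Unit using (tt) renaming (⊤ to ⊤₀)
open import Data.Empty renaming (⊥ to ⊥₀) using (⊥-elim)
open import Induction.WellFounded using (Acc; acc)
open import Relation.Nullary using (¬_; Dec; yes; no)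
open import Relation.Nullary.Decidable using (_×-dec_; _⊎-dec_; ¬?)
open import Relation.Binary.PropositionalEquality hiding ([_]; trans)
import Relation.Binary.PropositionalEquality as Eq
open import Function using (_∘_)
open import Function.Bundles using (_⇔_; mk⇔; Equivalence)
open Equivalence using (to; from)

private variable n : ℕ

_≟S_ : (p q : Subset n) → Dec (p ≡ q)
_≟S_ = ≡-dec _≟ᴮ_

∈∪ʳ : ∀ {x : Fin n} p {q} → x ∈ q → x ∈ p ∪ q
∈∪ʳ p = q⊆p∪q p _

∈∩⁺ : ∀ {x : Fin n} {p q} → x ∈ p → x ∈ q → x ∈ p ∩ q
∈∩⁺ a b = x∈p∩q⁺ (a , b)

∈─⁻ : ∀ {x : Fin n} p q → x ∈ p ─ q → x ∈ p × x ∉ q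
∈─⁻ p q i = p─q⊆p p q i , not-both p q i
  where
  not-both : ∀ {m} {x : Fin m} (p q : Subset m) → x ∈ p ─ q → x ∉ q
  not-both (_ ∷ p) (true ∷ q) () here
  not-both (_ ∷ p) (true ∷ q) (there i) (there j) = not-both p q i j
  not-both (_ ∷ p) (false ∷ q) (there i) (there j) = not-both p q i j

empty≡ : ∀ {p : Subset n} → (∀ {x} → x ∉ p) → p ≡ ⊥
empty≡ f = Empty-unique (λ (x , i) → f i)

disj⁻ : ∀ {p q : Subset n} {x} → Disjoint p q → x ∈ p → x ∉ q
disj⁻ d a b = ∉⊥ (subst (_ ∈_) d (∈∩⁺ a b))

disj⁺ : ∀ {p q : Subset n} → (∀ {x} → x ∈ p → x ∉ q) → Disjoint p q
disj⁺ {p = p} {q} f = empty≡ λ i → let (a , b) = x∈p∩q⁻ p q i in f a b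

∈≡ : ∀ {p q : Subset n} {x} → p ≡ q → x ∈ p → x ∈ q
∈≡ refl i = i

∉∪ : ∀ {x : Fin n} {p q} → x ∉ p → x ∉ q → x ∉ p ∪ q
∉∪ {p = p} {q} a b i = [ a , b ] (x∈p∪q⁻ p q i)

─-anti : ∀ (W : Subset n) {Y X} → Y ⊆ X → W ─ X ⊆ W ─ Y
─-anti W {Y} {X} yx i = let (a , b) = ∈─⁻ W X i in x∈p∧x∉q⇒x∈p─q a (b ∘ yx)

-- Restriction, and equality of hypergraphs up to extensionality
-- (needed because 𝐇_{A} restricted to B ⊆ A is not definitionally 𝐇_B)

edge-restrict⁻ : ∀ (G : Hyp n) A Z → Edge (restrict G A) Z → Edge G Z × Z ⊆ A
edge-restrict⁻ G A Z e with E G Z | Z ⊆? A | e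
... | true | yes s | _ = refl , s

edge-restrict⁺ : ∀ (G : Hyp n) A Z → Edge G Z → Z ⊆ A → Edge (restrict G A) Z
edge-restrict⁺ G A Z e s with E G Z | Z ⊆? A | e
... | true | yes _ | _ = refl
... | true | no ¬s | _ = ⊥-elim (¬s s)

record _≈H_ (G G' : Hyp n) : Set where
  constructor mk≈
  field
    ≈V : V G ≡ V G'
    ≈E : ∀ Z → E G Z ≡ E G' Z
open _≈H_ public

≈sym : ∀ {G G' : Hyp n} → G ≈H G' → G' ≈H G
≈sym (mk≈ v e) = mk≈ (sym v) (λ Z → sym (e Z))

≈trans : ∀ {G G' G'' : Hyp n} → G ≈H G' → G' ≈H G'' → G ≈H G''
≈trans (mk≈ v e) (mk≈ v' e') = mk≈ (Eq.trans v v') (λ Z → Eq.trans (e Z) (e' Z))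

≈restrict : ∀ {G G' : Hyp n} A → G ≈H G' → restrict G A ≈H restrict G' A
≈restrict A (mk≈ v e) = mk≈ refl (λ Z → cong (_∧ _) (e Z))

≈restrict' : ∀ {G G' : Hyp n} {A A'} → A ≡ A' → G ≈H G' → restrict G A ≈H restrict G' A'
≈restrict' refl q = ≈restrict _ q

restrict-restrict : ∀ (G : Hyp n) {A B} → A ⊆ B → restrict (restrict G B) A ≈H restrict G A
restrict-restrict G {A} {B} s = mk≈ refl same-edges
  where
  same-edges : ∀ Z → E (restrict (restrict G B) A) Z ≡ E (restrict G A) Z
  same-edges Z with E G Z | Z ⊆? A | Z ⊆? B
  ... | false | _     | _     = refl
  ... | true  | yes a | yes _ = refl
  ... | true  | yes a | no b  = ⊥-elim (b (s ∘ a))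
  ... | true  | no _  | yes _ = refl
  ... | true  | no _  | no _  = refl

Separation : Hyp n → Subset n → Subset n → Set
Separation H X₁ X₂ = Nonempty X₁ × Nonempty X₂ × Disjoint X₁ X₂ × (X₁ ∪ X₂ ≡ V H) ×
  (∀ Z → Edge H Z → (Z ⊆ X₁) ⊎ (Z ⊆ X₂))

connected-resp-≈H : ∀ {G G' : Hyp n} → G ≈H G' → Connected G → Connected G'
connected-resp-≈H (mk≈ v e) c (X₁ , X₂ , n₁ , n₂ , d , u , f) =
  c (X₁ , X₂ , n₁ , n₂ , d , Eq.trans u (sym v) , λ Z ez → f Z (Eq.trans (sym (e Z)) ez))

Conn : Hyp n → Subset n → Set
Conn G A = Connected (restrict G A)

connected-side : ∀ (G : Hyp n) A X₁ X₂ → Conn G A → (∀ {x} → x ∈ A → x ∈ X₁ ⊎ x ∈ X₂) →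
       (∀ {x} → x ∈ X₁ → x ∉ X₂) →
       (∀ Z → Edge G Z → Z ⊆ A → Z ⊆ X₁ ⊎ Z ⊆ X₂) → A ⊆ X₁ ⊎ A ⊆ X₂
connected-side G A X₁ X₂ c cov dj ed with nonempty? (A ∩ X₁) | nonempty? (A ∩ X₂)
... | yes ne₁ | yes ne₂ = ⊥-elim (c (A ∩ X₁ , A ∩ X₂ , ne₁ , ne₂ , disjoint , covers , edges))
  where
  disjoint : Disjoint (A ∩ X₁) (A ∩ X₂)
  disjoint = disj⁺ (λ i j → dj (proj₂ (x∈p∩q⁻ A X₁ i)) (proj₂ (x∈p∩q⁻ A X₂ j)))
  covers : (A ∩ X₁) ∪ (A ∩ X₂) ≡ A
  covers = ⊆-antisym (λ i → [ p∩q⊆p A X₁ , p∩q⊆p A X₂ ] (x∈p∪q⁻ (A ∩ X₁) (A ∩ X₂) i))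
                     (λ i → [ (λ j → p⊆p∪q (A ∩ X₂) (∈∩⁺ i j)) , (λ j → ∈∪ʳ (A ∩ X₁) (∈∩⁺ i j)) ] (cov i))
  edges : ∀ Z → Edge (restrict G A) Z → Z ⊆ A ∩ X₁ ⊎ Z ⊆ A ∩ X₂
  edges Z ez = let (e , s) = edge-restrict⁻ G A Z ez in
    [ (λ t → inj₁ (λ {_} z → ∈∩⁺ (s z) (t z))) , (λ t → inj₂ (λ {_} z → ∈∩⁺ (s z) (t z))) ] (ed Z e s)
... | yes _ | no ¬b = inj₁ λ {x} i → [ (λ j → j) , (λ j → ⊥-elim (¬b (x , ∈∩⁺ i j))) ] (cov i)
... | no ¬a | _ = inj₂ λ {x} i → [ (λ j → ⊥-elim (¬a (x , ∈∩⁺ i j))) , (λ j → j) ] (cov i)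

connected-∪ : ∀ (G : Hyp n) A B → Conn G A → Conn G B → Nonempty (A ∩ B) → Conn G (A ∪ B)
connected-∪ G A B cA cB (c , ic) (X₁ , X₂ , (y₁ , i₁) , (y₂ , i₂) , d , u , f) =
  both-sides (side A cA (p⊆p∪q B)) (side B cB (∈∪ʳ A))
  where
  side : ∀ C → Conn G C → C ⊆ A ∪ B → C ⊆ X₁ ⊎ C ⊆ X₂
  side C cC C⊆ = connected-side G C X₁ X₂ cC (λ i → x∈p∪q⁻ X₁ X₂ (∈≡ (sym u) (C⊆ i))) (disj⁻ d)
                   (λ Z e s → f Z (edge-restrict⁺ G (A ∪ B) Z e (C⊆ ∘ s)))
  c∈A = proj₁ (x∈p∩q⁻ A B ic)
  c∈B = proj₂ (x∈p∩q⁻ A B ic)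
  -- A and B share c, so they lie on the same side; the other side is then empty
  both-sides : A ⊆ X₁ ⊎ A ⊆ X₂ → B ⊆ X₁ ⊎ B ⊆ X₂ → ⊥₀
  both-sides (inj₁ a) (inj₁ b) = [ (λ j → disj⁻ d (a j) i₂) , (λ j → disj⁻ d (b j) i₂) ] (x∈p∪q⁻ A B (∈≡ u (∈∪ʳ X₁ i₂)))
  both-sides (inj₁ a) (inj₂ b) = disj⁻ d (a c∈A) (b c∈B)
  both-sides (inj₂ a) (inj₁ b) = disj⁻ d (b c∈B) (a c∈A)
  both-sides (inj₂ a) (inj₂ b) = [ (λ j → disj⁻ d i₁ (a j)) , (λ j → disj⁻ d i₁ (b j)) ] (x∈p∪q⁻ A B (∈≡ u (p⊆p∪q X₂ i₁)))

connected-⁅⁆ : ∀ (G : Hyp n) x → Conn G ⁅ x ⁆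
connected-⁅⁆ G x (X₁ , X₂ , (y₁ , i₁) , (y₂ , i₂) , d , u , f) =
  disj⁻ d (subst (_∈ X₁) (x∈⁅y⁆⇒x≡y x (∈≡ u (p⊆p∪q X₂ i₁))) i₁)
          (subst (_∈ X₂) (x∈⁅y⁆⇒x≡y x (∈≡ u (∈∪ʳ X₁ i₂))) i₂)

edge? : (G : Hyp n) → ∀ Z → Dec (Edge G Z)
edge? G Z = E G Z ≟ᴮ true

separation? : ∀ (H : Hyp n) X₁ X₂ → Dec (Separation H X₁ X₂)
separation? H X₁ X₂ =
  nonempty? X₁ ×-dec (nonempty? X₂ ×-dec (((X₁ ∩ X₂) ≟S ⊥) ×-dec (((X₁ ∪ X₂) ≟S V H) ×-dec edges?)))
  where
  edges? : Dec (∀ Z → Edge H Z → Z ⊆ X₁ ⊎ Z ⊆ X₂)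
  edges? with anySubset? (λ Z → edge? H Z ×-dec ¬? ((Z ⊆? X₁) ⊎-dec (Z ⊆? X₂)))
  ... | yes (Z , e , bad) = no λ g → bad (g Z e)
  ... | no none = yes λ Z e → decided Z e ((Z ⊆? X₁) ⊎-dec (Z ⊆? X₂))
    where
    decided : ∀ Z → Edge H Z → Dec (Z ⊆ X₁ ⊎ Z ⊆ X₂) → Z ⊆ X₁ ⊎ Z ⊆ X₂
    decided Z e (yes p) = p
    decided Z e (no q) = ⊥-elim (none (Z , e , q))

connected? : (H : Hyp n) → Dec (Connected H)
connected? H = ¬? (anySubset? λ X₁ → anySubset? λ X₂ → separation? H X₁ X₂)

module Component {G : Hyp n} {K : Subset n} (c : IsComponent G K) where
  nonempty : Nonempty K
  nonempty = proj₁ c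
  ⊆V : K ⊆ V G
  ⊆V = proj₁ (proj₂ c)
  connected : Conn G K
  connected = proj₁ (proj₂ (proj₂ c))
  maximal : ∀ K′ → K ⊆ K′ → K′ ⊆ V G → Conn G K′ → K′ ≡ K
  maximal = proj₂ (proj₂ (proj₂ c))

component-absorbs : ∀ (G : Hyp n) K A → IsComponent G K → A ⊆ V G → Conn G A → Nonempty (A ∩ K) → A ⊆ K
component-absorbs G K A cK sA cA (x , ix) i = ∈≡ K∪A≡K (∈∪ʳ K i)
  where
  open Component cK
  K∪A≡K : K ∪ A ≡ K
  K∪A≡K = maximal (K ∪ A) (p⊆p∪q A) (λ j → [ ⊆V , sA ] (x∈p∪q⁻ K A j))
            (connected-∪ G K A connected cA (x , ∈∩⁺ (proj₂ (x∈p∩q⁻ A K ix)) (proj₁ (x∈p∩q⁻ A K ix))))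

component-overlap⇒≡ : ∀ (G : Hyp n) K K' → IsComponent G K → IsComponent G K' → Nonempty (K ∩ K') → K ≡ K'
component-overlap⇒≡ G K K' cK cK' (x , ix) =
  ⊆-antisym (component-absorbs G K' K cK' (Component.⊆V cK) (Component.connected cK) (x , ix))
            (component-absorbs G K K' cK (Component.⊆V cK') (Component.connected cK')
               (x , ∈∩⁺ (proj₂ (x∈p∩q⁻ K K' ix)) (proj₁ (x∈p∩q⁻ K K' ix))))

-- every non-empty connected set C lies in a component: enlarge C as long as
-- a strictly larger connected set exists (well-founded since ⊃ is)
grow-component : ∀ (G : Hyp n) C → Acc _⊃_ C → C ⊆ V G → Conn G C → Nonempty C →
                 Σ _ λ K → IsComponent G K × C ⊆ K
grow-component G C (acc rs) C⊆V cC neC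
  with anySubset? (λ K' → (C ⊂? K') ×-dec ((K' ⊆? V G) ×-dec connected? (restrict G K')))
... | yes (K' , C⊂K' , K'⊆V , cK') =
  let (K , comp , K'⊆K) = grow-component G K' (rs C⊂K') K'⊆V cK' (proj₁ neC , proj₁ C⊂K' (proj₂ neC))
  in K , comp , K'⊆K ∘ proj₁ C⊂K'
... | no none = C , (neC , C⊆V , cC , maximal) , (λ i → i)
  where
  maximal : ∀ K' → C ⊆ K' → K' ⊆ V G → Conn G K' → K' ≡ C
  maximal K' C⊆K' K'⊆V cK' = ⊆-antisym K'⊆C C⊆K'
    where
    K'⊆C : K' ⊆ C
    K'⊆C {x} x∈K' with x ∈? C
    ... | yes x∈C = x∈C
    ... | no x∉C = ⊥-elim (none (K' , (C⊆K' , x , x∈K' , x∉C) , K'⊆V , cK'))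

component-of : ∀ (G : Hyp n) {x} → x ∈ V G → Σ _ λ K → IsComponent G K × x ∈ K
component-of G {x} ix =
  let (K , c , s) = grow-component G ⁅ x ⁆ (⊃-wellFounded _)
                      (λ i → subst (_∈ V G) (sym (x∈⁅y⁆⇒x≡y x i)) ix) (connected-⁅⁆ G x) (x , x∈⁅x⁆ x)
  in K , c , s (x∈⁅x⁆ x)

component-resp-≈H : ∀ {G G' : Hyp n} {K} → G ≈H G' → IsComponent G K → IsComponent G' K
component-resp-≈H {K = K} q (ne , sub , c , mx) =
  ne , (λ i → ∈≡ (≈V q) (sub i)) , connected-resp-≈H (≈restrict K q) c ,
  λ K' s1 s2 c' → mx K' s1 (λ i → ∈≡ (sym (≈V q)) (s2 i)) (connected-resp-≈H (≈restrict K' (≈sym q)) c')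

component-restrict : ∀ (G : Hyp n) K B → IsComponent G K → K ⊆ B → B ⊆ V G → IsComponent (restrict G B) K
component-restrict G K B (ne , sub , c , mx) kb bv =
  ne , kb , connected-resp-≈H (≈sym (restrict-restrict G kb)) c ,
  λ K' s1 s2 c' → mx K' s1 (bv ∘ s2) (connected-resp-≈H (restrict-restrict G s2) c')

component-lift : ∀ (G : Hyp n) B K → B ⊆ V G → IsComponent (restrict G B) K →
                 Σ _ λ K' → IsComponent G K' × K ⊆ K'
component-lift G B K bv ((x , ix) , kb , c , _) =
  let (K' , cK' , xK') = component-of G (bv (kb ix))
  in K' , cK' , component-absorbs G K' K cK' (bv ∘ kb) (connected-resp-≈H (restrict-restrict G kb) c) (x , ∈∩⁺ ix xK')

component-lift-≡ : ∀ (G : Hyp n) B K K' → B ⊆ V G → IsComponent (restrict G B) K → IsComponent G K' →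
                   K ⊆ K' → K' ⊆ B → K ≡ K'
component-lift-≡ G B K K' bv cK cK' s s' =
  sym (Component.maximal cK K' s s' (Component.connected (component-restrict G K' B cK' s' bv)))

component-self : ∀ (G : Hyp n) C → Nonempty C → Conn G C → IsComponent (restrict G C) C
component-self G C ne c =
  ne , (λ i → i) , connected-resp-≈H (≈sym (restrict-restrict G (λ i → i))) c , λ K' s1 s2 _ → ⊆-antisym s2 s1

component-unique : ∀ (G : Hyp n) C K → Conn G C → IsComponent (restrict G C) K → K ≡ C
component-unique G C K c cK =
  sym (Component.maximal cK C (Component.⊆V cK) (λ i → i) (connected-resp-≈H (≈sym (restrict-restrict G (λ i → i))) c))

component-∩⁺ : ∀ (G : Hyp n) A C K → IsComponent (restrict G A) K → K ⊆ C → IsComponent (restrict G (C ∩ A)) K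
component-∩⁺ G A C K cK kc =
  component-resp-≈H (restrict-restrict G (p∩q⊆q C A))
    (component-restrict (restrict G A) K (C ∩ A) cK (λ i → ∈∩⁺ (kc i) (Component.⊆V cK i)) (p∩q⊆q C A))

component-∩⁻ : ∀ (G : Hyp n) A B C K → A ⊆ B → IsComponent (restrict G B) C →
               IsComponent (restrict G (C ∩ A)) K → IsComponent (restrict G A) K × K ⊆ C
component-∩⁻ G A B C K ab cC cK = subst (IsComponent (restrict G A)) (sym K≡K') cK' , K⊆C
  where
  K⊆C : K ⊆ C
  K⊆C i = p∩q⊆p C A (Component.⊆V cK i)
  cK₁ : IsComponent (restrict (restrict G A) (C ∩ A)) K
  cK₁ = component-resp-≈H (≈sym (restrict-restrict G (p∩q⊆q C A))) cK
  -- K lies in a component K' of G_A; K' is connected in G_B and meets C, so K' ⊆ C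
  lifted = component-lift (restrict G A) (C ∩ A) K (p∩q⊆q C A) cK₁
  K' = proj₁ lifted
  cK' = proj₁ (proj₂ lifted)
  K⊆K' = proj₂ (proj₂ lifted)
  K'⊆A = Component.⊆V cK'
  K'⊆C : K' ⊆ C
  K'⊆C = component-absorbs (restrict G B) C K' cC (ab ∘ K'⊆A)
           (connected-resp-≈H (≈trans (restrict-restrict G K'⊆A) (≈sym (restrict-restrict G (ab ∘ K'⊆A))))
                              (Component.connected cK'))
           (let (x , xK) = Component.nonempty cK in x , ∈∩⁺ (K⊆K' xK) (K⊆C xK))
  K≡K' : K ≡ K'
  K≡K' = component-lift-≡ (restrict G A) (C ∩ A) K K' (p∩q⊆q C A) cK₁ cK' K⊆K' (λ i → ∈∩⁺ (K'⊆C i) (K'⊆A i))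

unique-resp-↭ : ∀ {A : Set} {xs ys : List A} → Unique xs → xs ↭ ys → Unique ys
unique-resp-↭ u refl = u
unique-resp-↭ (a ∷ u) (prep x p) = All-resp-↭ p a ∷ unique-resp-↭ u p
unique-resp-↭ ((a1 ∷ a) ∷ b ∷ u) (swap x y p) = ((λ e → a1 (sym e)) ∷ All-resp-↭ p b) ∷ All-resp-↭ p a ∷ unique-resp-↭ u p
unique-resp-↭ u (trans p q) = unique-resp-↭ (unique-resp-↭ u p) q

unique-head : ∀ {A : Set} {x : A} {xs} → Unique (x ∷ xs) → x ∈L xs → ⊥₀
unique-head = UP.Unique[x∷xs]⇒x∉xs

unique-tail : ∀ {A : Set} {x : A} {xs} → Unique (x ∷ xs) → Unique xs
unique-tail (_ ∷ u) = u

module ComponentList {G : Hyp n} {Ks : List (Subset n)} (cl : Components G Ks) where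
  uniq : Unique Ks
  uniq = proj₁ cl
  comp : ∀ {K} → K ∈L Ks → IsComponent G K
  comp {K} m = to (proj₂ cl K) m
  mem : ∀ {K} → IsComponent G K → K ∈L Ks
  mem {K} c = from (proj₂ cl K) c
  sub : ∀ {K} → K ∈L Ks → K ⊆ V G
  sub m = Component.⊆V (comp m)
  ne : ∀ {K} → K ∈L Ks → Nonempty K
  ne m = Component.nonempty (comp m)
  conn : ∀ {K} → K ∈L Ks → Conn G K
  conn m = Component.connected (comp m)
  eqp : ∀ {K K' x} → K ∈L Ks → K' ∈L Ks → x ∈ K → x ∈ K' → K ≡ K'
  eqp {x = x} m m' a b = component-overlap⇒≡ G _ _ (comp m) (comp m') (x , ∈∩⁺ a b)
  sub⇒eq : ∀ {K K'} → K ∈L Ks → K' ∈L Ks → K' ⊆ K → K' ≡ K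
  sub⇒eq m m' s = let (x , ix) = ne m' in eqp m' m ix (s ix)
  cover : ∀ {x} → x ∈ V G → Σ _ λ K → K ∈L Ks × x ∈ K
  cover ix = let (K , c , xk) = component-of G ix in K , mem c , xk

components-resp-≈H : ∀ {G G' : Hyp n} {Ks} → G ≈H G' → Components G Ks → Components G' Ks
components-resp-≈H q (u , f) =
  u , λ K → mk⇔ (λ m → component-resp-≈H q (to (f K) m)) (λ c → from (f K) (component-resp-≈H (≈sym q) c))

leads-resp-≈H : ∀ {G G' : Hyp n} {Y Ks} → G ≈H G' → Leads G Y Ks → Leads G' Y Ks
leads-resp-≈H {Y = Y} q l = components-resp-≈H (≈restrict' (cong (_─ Y) (≈V q)) q) l

components-resp-↭ : ∀ {G : Hyp n} {Ks Ks'} → Components G Ks → Ks ↭ Ks' → Components G Ks'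
components-resp-↭ (u , f) p =
  unique-resp-↭ u p , λ K → mk⇔ (λ m → to (f K) (∈-resp-↭ (↭-sym p) m)) (λ c → ∈-resp-↭ p (from (f K) c))

module LeadsFacts {G : Hyp n} {Y : Subset n} {Ks : List (Subset n)} (l : Leads G Y Ks) where
  open ComponentList l public
  subV : ∀ {K} → K ∈L Ks → K ⊆ V G
  subV m i = proj₁ (∈─⁻ (V G) Y (sub m i))
  notY : ∀ {K x} → K ∈L Ks → x ∈ K → x ∉ Y
  notY m i = proj₂ (∈─⁻ (V G) Y (sub m i))
  coverY : ∀ {x} → x ∈ V G → x ∉ Y → Σ _ λ K → K ∈L Ks × x ∈ K
  coverY a b = cover (x∈p∧x∉q⇒x∈p─q a b)
  connG : ∀ {K} → K ∈L Ks → Conn G K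
  connG m = connected-resp-≈H (restrict-restrict G (sub m)) (conn m)

leads-⊇V : ∀ {G : Hyp n} {Y Ks} → V G ⊆ Y → Leads G Y Ks → Ks ≡ []
leads-⊇V {Ks = []} s l = refl
leads-⊇V {Ks = K ∷ Ks} s l =
  let open LeadsFacts l ; (x , ix) = ne (here refl) in ⊥-elim (notY (here refl) ix (s (subV (here refl) ix)))

merge-complement : ∀ (G : Hyp n) {Y X K₁ Ks} → Leads G Y (K₁ ∷ Ks) → X ⊆ K₁ →
                   (K₁ ─ X ≡ K₁ ∩ (V G ─ (Y ∪ X))) × (∀ {C} → C ∈L Ks → C ∩ (V G ─ (Y ∪ X)) ≡ C)
merge-complement G {Y} {X} {K₁} {Ks} L xk = K₁─X , other∩A
  where
  open LeadsFacts L
  A = V G ─ (Y ∪ X)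
  K₁─X : K₁ ─ X ≡ K₁ ∩ A
  K₁─X = ⊆-antisym
    (λ i → let (a , b) = ∈─⁻ K₁ X i in
           ∈∩⁺ a (x∈p∧x∉q⇒x∈p─q (subV (here refl) a) (∉∪ (notY (here refl) a) b)))
    (λ i → let (a , b) = x∈p∩q⁻ K₁ A i in x∈p∧x∉q⇒x∈p─q a (λ x → proj₂ (∈─⁻ (V G) (Y ∪ X) b) (∈∪ʳ Y x)))
  X∉other : ∀ {C x} → C ∈L Ks → x ∈ C → x ∉ X
  X∉other m i j = unique-head uniq (subst (_∈L Ks) (eqp (there m) (here refl) i (xk j)) m)
  other∩A : ∀ {C} → C ∈L Ks → C ∩ A ≡ C
  other∩A m = ⊆-antisym (p∩q⊆p _ A)
    (λ i → ∈∩⁺ i (x∈p∧x∉q⇒x∈p─q (subV (there m) i) (∉∪ (notY (there m) i) (X∉other m i))))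

-- The merging lemma: if 𝐇,Y ⇝ K₁,Ks and 𝐊₁,X ⇝ H₁s with X ⊆ K₁, then
-- 𝐇,Y∪X ⇝ H₁s,Ks.  (This is what makes the merge step of ≤ well-formed.)
leads-merge : ∀ (G : Hyp n) Y X K₁ Ks H₁s → Leads G Y (K₁ ∷ Ks) → X ⊆ K₁ → Leads (restrict G K₁) X H₁s →
              Leads G (Y ∪ X) (H₁s ++ Ks)
leads-merge G Y X K₁ Ks H₁s L xk L₁ = UP.++⁺ (proj₁ L₁) (unique-tail (proj₁ L)) disjoint , λ K → mk⇔ (fwd K) (bwd K)
  where
  module L = LeadsFacts L
  module L₁ = ComponentList L₁
  B = V G ─ Y
  A = V G ─ (Y ∪ X)
  ab : A ⊆ B
  ab = ─-anti (V G) (p⊆p∪q X)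
  K₁─X = proj₁ (merge-complement G L xk)
  other∩A = proj₂ (merge-complement G L xk)
  disjoint : ∀ {v} → ¬ (v ∈L H₁s × v ∈L Ks)
  disjoint (m₁ , m) = let (x , ix) = L₁.ne m₁ in
    unique-head (proj₁ L) (subst (_∈L Ks) (L.eqp (there m) (here refl) ix (proj₁ (∈─⁻ K₁ X (L₁.sub m₁ ix)))) m)
  -- the H₁s are components of 𝐊₁ ∖ X = K₁ ∩ (𝐇 ∖ (Y∪X)); the Ks are untouched
  fwd : ∀ K → K ∈L H₁s ++ Ks → IsComponent (restrict G A) K
  fwd K m with ∈-++⁻ H₁s m
  ... | inj₁ m₁ = proj₁ (component-∩⁻ G A B K₁ K ab (L.comp (here refl))
                    (subst (λ S → IsComponent (restrict G S) K) K₁─X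
                       (component-resp-≈H (restrict-restrict G (p─q⊆p K₁ X)) (L₁.comp m₁))))
  ... | inj₂ m₂ = proj₁ (component-∩⁻ G A B K K ab (L.comp (there m₂))
                    (subst (λ S → IsComponent (restrict G S) K) (sym (other∩A m₂))
                       (component-self G K (L.ne (there m₂)) (L.connG (there m₂)))))
  -- a component of 𝐇 ∖ (Y∪X) lies in some Kᵢ; in K₁ it is one of H₁s, elsewhere it is Kᵢ itself
  bwd : ∀ K → IsComponent (restrict G A) K → K ∈L H₁s ++ Ks
  bwd K cK with component-lift (restrict G B) A K ab (component-resp-≈H (≈sym (restrict-restrict G ab)) cK)
  ... | C , cC , kc with L.mem cC
  ... | here refl = ∈-++⁺ˡ (L₁.mem (component-resp-≈H (≈sym (restrict-restrict G (p─q⊆p K₁ X)))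
                      (subst (λ S → IsComponent (restrict G S) K) (sym K₁─X) (component-∩⁺ G A C K cK kc))))
  ... | there m = ∈-++⁺ʳ H₁s (subst (_∈L Ks) (sym (component-unique G C K (L.connG (there m))
                      (subst (λ S → IsComponent (restrict G S) K) (other∩A m) (component-∩⁺ G A C K cK kc)))) m)

leads-inside : ∀ (G : Hyp n) Z Y L Ks Ks' → Z ⊆ Y → IsComponent (restrict G (V G ─ Z)) L → Leads G Y Ks →
               Unique Ks' → (∀ K → K ∈L Ks' ⇔ (K ∈L Ks × K ⊆ L)) → Leads (restrict G L) (L ∩ Y) Ks'
leads-inside G Z Y L Ks Ks' zy cL lY u f = u , λ K → mk⇔ (fwd K) (bwd K)
  where
  module LY = LeadsFacts lY
  A = V G ─ Y
  L⊆V : L ⊆ V G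
  L⊆V i = proj₁ (∈─⁻ (V G) Z (Component.⊆V cL i))
  L─Y : L ─ (L ∩ Y) ≡ L ∩ A
  L─Y = ⊆-antisym
    (λ i → let (a , b) = ∈─⁻ L (L ∩ Y) i in ∈∩⁺ a (x∈p∧x∉q⇒x∈p─q (L⊆V a) (λ y → b (∈∩⁺ a y))))
    (λ i → let (a , b) = x∈p∩q⁻ L A i in x∈p∧x∉q⇒x∈p─q a (λ j → proj₂ (∈─⁻ (V G) Y b) (p∩q⊆q L Y j)))
  sl : L ─ (L ∩ Y) ⊆ L
  sl = p─q⊆p L (L ∩ Y)
  fwd : ∀ K → K ∈L Ks' → IsComponent (restrict (restrict G L) (L ─ (L ∩ Y))) K
  fwd K m = let (mK , kL) = to (f K) m in
    component-resp-≈H (≈sym (restrict-restrict G sl))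
      (subst (λ S → IsComponent (restrict G S) K) (sym L─Y) (component-∩⁺ G A L K (LY.comp mK) kL))
  bwd : ∀ K → IsComponent (restrict (restrict G L) (L ─ (L ∩ Y))) K → K ∈L Ks'
  bwd K c =
    let (cK , kL) = component-∩⁻ G A (V G ─ Z) L K (─-anti (V G) zy) cL
                      (subst (λ S → IsComponent (restrict G S) K) L─Y (component-resp-≈H (restrict-restrict G sl) c))
    in from (f K) (LY.mem cK , kL)

component-shrink : ∀ (G : Hyp n) Z Y L → Z ⊆ Y → IsComponent (restrict G (V G ─ Z)) L → (∀ {x} → x ∈ L → x ∉ Y) →
                   IsComponent (restrict G (V G ─ Y)) L
component-shrink G Z Y L zy cL ly =
  proj₁ (component-∩⁻ G A (V G ─ Z) L L (─-anti (V G) zy) cL (subst (λ S → IsComponent (restrict G S) L) (sym L∩A)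
           (component-self G L (Component.nonempty cL)
              (connected-resp-≈H (restrict-restrict G (Component.⊆V cL)) (Component.connected cL)))))
  where
  A = V G ─ Y
  L∩A : L ∩ A ≡ L
  L∩A = ⊆-antisym (p∩q⊆p L A)
    (λ i → ∈∩⁺ i (x∈p∧x∉q⇒x∈p─q (proj₁ (∈─⁻ (V G) Z (Component.⊆V cL i))) (ly i)))

component-refines : ∀ (G : Hyp n) Y X Ks H → Y ⊆ X → Leads G Y Ks → IsComponent (restrict G (V G ─ X)) H →
                    Σ _ λ K → K ∈L Ks × H ⊆ K
component-refines G Y X Ks H yx l cH =
  let (C , cC , hc) = component-lift (restrict G (V G ─ Y)) (V G ─ X) H ab
                        (component-resp-≈H (≈sym (restrict-restrict G ab)) cH)
  in C , LeadsFacts.mem l cC , hc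
  where
  ab = ─-anti (V G) yx

module _ {A B : Set} where
  zip∈ˡ : ∀ {xs : List A} {ys : List B} {a b} → (a , b) ∈L zip xs ys → a ∈L xs
  zip∈ˡ {_ ∷ xs} {_ ∷ ys} (here refl) = here refl
  zip∈ˡ {_ ∷ xs} {_ ∷ ys} (there m) = there (zip∈ˡ m)

  zip∈ʳ : ∀ {xs : List A} {ys : List B} {a b} → (a , b) ∈L zip xs ys → b ∈L ys
  zip∈ʳ {_ ∷ xs} {_ ∷ ys} (here refl) = here refl
  zip∈ʳ {_ ∷ xs} {_ ∷ ys} (there m) = there (zip∈ʳ m)

  pw∈ : ∀ {R : A → B → Set} {xs ys a b} → Pointwise R xs ys → (a , b) ∈L zip xs ys → R a b
  pw∈ (r ∷ pw) (here refl) = r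
  pw∈ (r ∷ pw) (there m) = pw∈ pw m

  pw∈ˡ : ∀ {R : A → B → Set} {xs ys a} → Pointwise R xs ys → a ∈L xs → Σ B λ b → (a , b) ∈L zip xs ys
  pw∈ˡ (_∷_ {y = y} r pw) (here refl) = y , here refl
  pw∈ˡ (r ∷ pw) (there m) = let (b , m') = pw∈ˡ pw m in b , there m'

  pw∈ʳ : ∀ {R : A → B → Set} {xs ys b} → Pointwise R xs ys → b ∈L ys → Σ A λ a → (a , b) ∈L zip xs ys
  pw∈ʳ (_∷_ {x = x} r pw) (here refl) = x , here refl
  pw∈ʳ (r ∷ pw) (there m) = let (a , m') = pw∈ʳ pw m in a , there m'

  pw-build : ∀ {R R' : A → B → Set} {xs ys} → Pointwise R xs ys →
             (∀ {a b} → (a , b) ∈L zip xs ys → R' a b) → Pointwise R' xs ys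
  pw-build [] f = []
  pw-build (r ∷ pw) f = f (here refl) ∷ pw-build pw (f ∘ there)

  pw-map-self : ∀ {R : A → B → Set} (f : A → B) {xs} → (∀ {x} → x ∈L xs → R x (f x)) → Pointwise R xs (map f xs)
  pw-map-self f {[]} g = []
  pw-map-self f {x ∷ xs} g = g (here refl) ∷ pw-map-self f (g ∘ there)

  pw-fst : ∀ {R : A → B → Set} {xs ys} → Pointwise R xs ys → map proj₁ (zip xs ys) ≡ xs
  pw-fst [] = refl
  pw-fst (r ∷ pw) = cong (_ ∷_) (pw-fst pw)

  pw-snd : ∀ {R : A → B → Set} {xs ys} → Pointwise R xs ys → map proj₂ (zip xs ys) ≡ ys
  pw-snd [] = refl
  pw-snd (r ∷ pw) = cong (_ ∷_) (pw-snd pw)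

  zip-map : (ps : List (A × B)) → zip (map proj₁ ps) (map proj₂ ps) ≡ ps
  zip-map [] = refl
  zip-map ((a , b) ∷ ps) = cong (_ ∷_) (zip-map ps)

  zip-++ : ∀ {R : A → B → Set} {xs ys} (xs' : List A) (ys' : List B) → Pointwise R xs ys →
           zip (xs ++ xs') (ys ++ ys') ≡ zip xs ys ++ zip xs' ys'
  zip-++ xs' ys' [] = refl
  zip-++ xs' ys' (r ∷ pw) = cong (_ ∷_) (zip-++ xs' ys' pw)

  pw-from-pairs : ∀ {R : A → B → Set} (ps : List (A × B)) → (∀ {a b} → (a , b) ∈L ps → R a b) →
                  Pointwise R (map proj₁ ps) (map proj₂ ps)
  pw-from-pairs [] f = []
  pw-from-pairs ((a , b) ∷ ps) f = f (here refl) ∷ pw-from-pairs ps (f ∘ there)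

  unique-key : ∀ {xs : List A} {ys : List B} {a b b'} → Unique xs → (a , b) ∈L zip xs ys → (a , b') ∈L zip xs ys → b ≡ b'
  unique-key {_ ∷ xs} {_ ∷ ys} u (here refl) (here refl) = refl
  unique-key {_ ∷ xs} {_ ∷ ys} u (here refl) (there m) = ⊥-elim (unique-head u (zip∈ˡ m))
  unique-key {_ ∷ xs} {_ ∷ ys} u (there m) (here refl) = ⊥-elim (unique-head u (zip∈ˡ m))
  unique-key {_ ∷ xs} {_ ∷ ys} u (there m) (there m') = unique-key (unique-tail u) m m'

  key∈ : ∀ {ps : List (A × B)} {a} → a ∈L map proj₁ ps → Σ B λ b → (a , b) ∈L ps
  key∈ m with ∈-map⁻ proj₁ m
  ... | (a , b) , m' , refl = b , m'

  keyval : ∀ {g : A → B} {xs} {x} → x ∈L xs → (x , g x) ∈L zip xs (map g xs)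
  keyval (here refl) = here refl
  keyval (there m) = there (keyval m)

  perm-align : ∀ {R : A → B → Set} {xs ys zs} → Pointwise R xs ys → ys ↭ zs →
               Σ (List A) λ xs' → (xs ↭ xs') × Pointwise R xs' zs × (zip xs ys ↭ zip xs' zs)
  perm-align pw refl = _ , refl , pw , refl
  perm-align (r ∷ pw) (prep y p) = let (xs' , a , b , c) = perm-align pw p in _ , prep _ a , r ∷ b , prep _ c
  perm-align (r ∷ r' ∷ pw) (swap y y' p) = let (xs' , a , b , c) = perm-align pw p in _ , swap _ _ a , r' ∷ r ∷ b , swap _ _ c
  perm-align pw (trans p q) =
    let (xs' , a , b , c) = perm-align pw p
        (xs'' , a' , b' , c') = perm-align b q
    in xs'' , trans a a' , b' , trans c c'

module _ {A B C : Set} where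
  zip3 : ∀ {R : A → B → Set} {R' : A → C → Set} {xs ys zs a b} → Pointwise R xs ys → Pointwise R' xs zs →
         (a , b) ∈L zip xs ys → Σ C λ c → (a , (b , c)) ∈L zip xs (zip ys zs) × (a , c) ∈L zip xs zs
  zip3 (_ ∷ _) (_∷_ {y = c} _ _) (here refl) = c , here refl , here refl
  zip3 (_ ∷ p) (_ ∷ p') (there m) = let (c , m1 , m2) = zip3 p p' m in c , there m1 , there m2

  zipmap∈ : ∀ {g : A → B} {xs : List A} {zs : List C} {a b c} → (a , (b , c)) ∈L zip xs (zip (map g xs) zs) →
            b ≡ g a × (a , c) ∈L zip xs zs
  zipmap∈ {xs = x ∷ xs} {z ∷ zs} (here refl) = refl , here refl
  zipmap∈ {xs = x ∷ xs} {z ∷ zs} (there m) = let (e , m') = zipmap∈ m in e , there m'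

  pw-skel : ∀ {R : A → C → Set} {g : A → B} {xs zs} → Pointwise R xs zs → Pointwise (λ _ _ → ⊤₀) xs (zip (map g xs) zs)
  pw-skel [] = []
  pw-skel (r ∷ p) = tt ∷ pw-skel p

select-pairs : Subset n → List (Subset n × Tree n) → List (Subset n × Tree n)
select-pairs K [] = []
select-pairs K ((H , T) ∷ ps) with H ⊆? K
... | yes _ = (H , T) ∷ select-pairs K ps
... | no  _ = select-pairs K ps

select≡map : ∀ (K : Subset n) ps → select K ps ≡ map proj₂ (select-pairs K ps)
select≡map K [] = refl
select≡map K ((H , T) ∷ ps) with H ⊆? K
... | yes _ = cong (T ∷_) (select≡map K ps)
... | no  _ = select≡map K ps

select-pairs∈⁻ : ∀ {K : Subset n} {ps H T} → (H , T) ∈L select-pairs K ps → (H , T) ∈L ps × H ⊆ K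
select-pairs∈⁻ {K = K} {(H' , T') ∷ ps} m with H' ⊆? K | m
... | yes s | here refl = here refl , s
... | yes s | there m' = let (a , b) = select-pairs∈⁻ m' in there a , b
... | no _  | m' = let (a , b) = select-pairs∈⁻ m' in there a , b

select-pairs∈⁺ : ∀ {K : Subset n} {ps H T} → (H , T) ∈L ps → H ⊆ K → (H , T) ∈L select-pairs K ps
select-pairs∈⁺ {K = K} {(H' , T') ∷ ps} m s with H' ⊆? K | m
... | yes _ | here refl = here refl
... | yes _ | there m' = there (select-pairs∈⁺ m' s)
... | no ns | here refl = ⊥-elim (ns s)
... | no _  | there m' = select-pairs∈⁺ m' s

select-pairs-unique : ∀ {K : Subset n} {ps} → Unique (map proj₁ ps) → Unique (map proj₁ (select-pairs K ps))
select-pairs-unique {K = K} {[]} u = u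
select-pairs-unique {K = K} {(H , T) ∷ ps} (a ∷ u) with H ⊆? K
... | yes _ = still-distinct a ∷ select-pairs-unique u
  where
  still-distinct : ∀ {qs} → All (λ y → H ≢ y) (map proj₁ qs) → All (λ y → H ≢ y) (map proj₁ (select-pairs K qs))
  still-distinct {[]} a = a
  still-distinct {(H' , T') ∷ qs} (x ∷ a) with H' ⊆? K
  ... | yes _ = x ∷ still-distinct a
  ... | no _ = still-distinct a
... | no _ = select-pairs-unique u

select-keys : Subset n → List (Subset n) → List (Tree n) → List (Subset n)
select-keys K xs ys = map proj₁ (select-pairs K (zip xs ys))

select-pointwise : ∀ {R : Subset n → Tree n → Set} {K xs ys} → Pointwise R xs ys →
                   Pointwise R (select-keys K xs ys) (select K (zip xs ys))
select-pointwise {K = K} {xs} {ys} pw = subst (Pointwise _ (select-keys K xs ys)) (sym (select≡map K (zip xs ys)))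
  (pw-from-pairs (select-pairs K (zip xs ys)) λ m → pw∈ pw (proj₁ (select-pairs∈⁻ m)))

zip-select : ∀ (K : Subset n) xs ys → zip (select-keys K xs ys) (select K (zip xs ys)) ≡ select-pairs K (zip xs ys)
zip-select K xs ys = Eq.trans (cong (zip (select-keys K xs ys)) (select≡map K (zip xs ys))) (zip-map (select-pairs K (zip xs ys)))

select-keys-unique : ∀ {R : Subset n → Tree n → Set} {K xs ys} → Pointwise R xs ys → Unique xs → Unique (select-keys K xs ys)
select-keys-unique {K = K} {xs} {ys} pw u = select-pairs-unique {K = K} {zip xs ys} (subst Unique (sym (pw-fst pw)) u)

select-keys∈ : ∀ {R : Subset n → Tree n → Set} {K xs ys} → Pointwise R xs ys →
               ∀ H → H ∈L select-keys K xs ys ⇔ (H ∈L xs × H ⊆ K)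
select-keys∈ {K = K} {xs} {ys} pw H = mk⇔ f g
  where
  f : H ∈L select-keys K xs ys → H ∈L xs × H ⊆ K
  f m with ∈-map⁻ proj₁ m
  ... | (H' , T) , m' , refl = let (a , b) = select-pairs∈⁻ m' in zip∈ˡ a , b
  g : H ∈L xs × H ⊆ K → H ∈L select-keys K xs ys
  g (m , s) = let (T , m') = pw∈ˡ pw m in ∈-map⁺ proj₁ (select-pairs∈⁺ m' s)

select-keys⁻ : ∀ {L : Subset n} {xs ys a b} → (a , b) ∈L zip (select-keys L xs ys) (select L (zip xs ys)) →
               (a , b) ∈L zip xs ys × a ⊆ L
select-keys⁻ {L = L} {xs} {ys} m = select-pairs∈⁻ (subst (λ zs → (_ , _) ∈L zs) (zip-select L xs ys) m)

select-none : ∀ {K : Subset n} {ps} → (∀ {H T} → (H , T) ∈L ps → ¬ H ⊆ K) → select K ps ≡ []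
select-none {K = K} {[]} f = refl
select-none {K = K} {(H , T) ∷ ps} f with H ⊆? K
... | yes s = ⊥-elim (f (here refl) s)
... | no _ = select-none (f ∘ there)

select-one : ∀ {K : Subset n} {xs ys T} → Unique xs → (∀ {H} → H ∈L xs → H ⊆ K → H ≡ K) →
             (K , T) ∈L zip xs ys → select K (zip xs ys) ≡ T ∷ []
select-one {K = K} {H ∷ xs} {T' ∷ ys} u f m with H ⊆? K | m
... | yes s | here refl =
  cong (T' ∷_) (select-none (λ m' s' → unique-head u (subst (_∈L xs) (f (there (zip∈ˡ m')) s') (zip∈ˡ m'))))
... | yes s | there m' = ⊥-elim (unique-head u (subst (_∈L xs) (sym (f (here refl) s)) (zip∈ˡ m')))
... | no ns | here refl = ⊥-elim (ns (λ i → i))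
... | no _  | there m' = select-one (unique-tail u) (f ∘ there) m'

select-all : ∀ {K : Subset n} {ps} → (∀ {H T} → (H , T) ∈L ps → H ⊆ K) → select K ps ≡ map proj₂ ps
select-all {K = K} {[]} f = refl
select-all {K = K} {(H , T) ∷ ps} f with H ⊆? K
... | yes _ = cong (T ∷_) (select-all (f ∘ there))
... | no ns = ⊥-elim (ns (f (here refl)))

select-++ : ∀ (K : Subset n) ps qs → select K (ps ++ qs) ≡ select K ps ++ select K qs
select-++ K [] qs = refl
select-++ K ((H , T) ∷ ps) qs with H ⊆? K
... | yes _ = cong (T ∷_) (select-++ K ps qs)
... | no _ = select-++ K ps qs

select-select-pairs : ∀ {K L : Subset n} → K ⊆ L → ∀ ps → select K (select-pairs L ps) ≡ select K ps
select-select-pairs kl [] = refl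
select-select-pairs {K = K} {L} kl ((H , T) ∷ ps) with H ⊆? L
... | yes _ with H ⊆? K
...   | yes _ = cong (T ∷_) (select-select-pairs kl ps)
...   | no _ = select-select-pairs kl ps
select-select-pairs {K = K} {L} kl ((H , T) ∷ ps) | no hl with H ⊆? K
...   | yes hk = ⊥-elim (hl (kl ∘ hk))
...   | no _ = select-select-pairs kl ps

ConstructOn : Hyp n → Subset n → Tree n → Set
ConstructOn G K T = Construct (restrict G K) T

root-label : Tree n → Subset n
root-label (node Y _) = Y

construct-root : ∀ {G : Hyp n} {T} → Construct G T → Nonempty (root-label T) × root-label T ⊆ V G
construct-root (whole ne) = ne , λ i → i
construct-root (root ne ys _ _ _) = ne , ys

-- the components are determined by the children: two lists of components
-- carrying the same list of constructs coincide (roots lie in their component)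
aligned-components-≡ : ∀ {G G' : Hyp n} {Ks₁ Ks₂ Ss} →
  (∀ {K} → K ∈L Ks₁ → IsComponent G' K) → (∀ {K} → K ∈L Ks₂ → IsComponent G' K) →
  Pointwise (ConstructOn G) Ks₁ Ss → Pointwise (ConstructOn G) Ks₂ Ss → Ks₁ ≡ Ks₂
aligned-components-≡ f g [] [] = refl
aligned-components-≡ {G = G} {G' = G'} f g (c₁ ∷ p₁) (c₂ ∷ p₂) =
  let ((x , ix) , s₁) = construct-root c₁ ; (_ , s₂) = construct-root c₂
  in cong₂ _∷_ (component-overlap⇒≡ G' _ _ (f (here refl)) (g (here refl)) (x , ∈∩⁺ (s₁ ix) (s₂ ix)))
               (aligned-components-≡ {G = G} {G' = G'} (f ∘ there) (g ∘ there) p₁ p₂)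

leads-unique : ∀ {G : Hyp n} {Y Ks₁ Ks₂ Ss} → Leads G Y Ks₁ → Leads G Y Ks₂ →
               Pointwise (ConstructOn G) Ks₁ Ss → Pointwise (ConstructOn G) Ks₂ Ss → Ks₁ ≡ Ks₂
leads-unique {G = G} {Y} l₁ l₂ =
  aligned-components-≡ {G = G} {G' = restrict G (V G ─ Y)} (ComponentList.comp l₁) (ComponentList.comp l₂)

components-↭ : ∀ {G : Hyp n} {Ks Hs} → Components G Ks → Components G Hs → Ks ↭ Hs
components-↭ (u , f) (u' , f') =
  ∼bag⇒↭ (unique∧set⇒bag u u' (λ {K} → mk⇔ (λ m → from (f' K) (to (f K) m)) (λ m → from (f K) (to (f' K) m))))

leads-nil : ∀ {G : Hyp n} → Leads G (V G) []
leads-nil {G = G} = [] , λ K → mk⇔ (λ ()) (λ c → ⊥-elim (no-component K c))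
  where
  no-component : ∀ K → IsComponent (restrict G (V G ─ V G)) K → ⊥₀
  no-component K ((x , ix) , s , _) = let (a , b) = ∈─⁻ (V G) (V G) (s ix) in b a

leads-≢V : ∀ {G : Hyp n} {Y Ks} → Leads G Y Ks → Ks ≢ [] → Y ≢ V G
leads-≢V L ne e = ne (leads-⊇V (λ i → ∈≡ (sym e) i) L)

-- smart constructor: the root label may be all of V G (then there are no children)
construct-node : ∀ {G : Hyp n} {X Hs Ts} → Nonempty X → X ⊆ V G → Leads G X Hs →
                 Pointwise (ConstructOn G) Hs Ts → Construct G (node X Ts)
construct-node {G = G} {X} ne xv l pw with X ≟S V G
... | no xn = root ne xv xn l pw
... | yes refl with leads-⊇V (λ i → i) l
... | refl with pw
... | [] = whole ne

construct-node⁻ : ∀ {G : Hyp n} {Y Ts} → Construct G (node Y Ts) →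
                  Σ _ λ Ks → Leads G Y Ks × Pointwise (ConstructOn G) Ks Ts × Nonempty Y × Y ⊆ V G
construct-node⁻ (whole ne) = [] , leads-nil , [] , ne , λ i → i
construct-node⁻ (root ne ys _ l pw) = _ , l , pw , ne , ys

≈T-refl : (T : Tree n) → T ≈T T
≈T-refls : (ts : List (Tree n)) → Pointwise _≈T_ ts ts
≈T-refl (node Y ts) = node≈ refl (≈T-refls ts)
≈T-refls [] = []
≈T-refls (t ∷ ts) = ≈T-refl t ∷ ≈T-refls ts

construct-resp-≈T : ∀ {G : Hyp n} {S T} → Construct G S → S ≈T T → Construct G T
constructs-resp-≈T : ∀ {G : Hyp n} {Ks us ts} → Pointwise (ConstructOn G) Ks us → Pointwise _≈T_ us ts →
                     Pointwise (ConstructOn G) Ks ts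
construct-resp-≈T (whole ne) (node≈ p pw) with ↭-empty-inv (↭-sym p)
... | refl with pw
... | [] = whole ne
construct-resp-≈T {G = G} (root ne ys yn l cs) (node≈ p pw) =
  let (Ks' , kp , cs' , _) = perm-align cs p in root ne ys yn (components-resp-↭ l kp) (constructs-resp-≈T {G = G} cs' pw)
constructs-resp-≈T [] [] = []
constructs-resp-≈T {G = G} (c ∷ cs) (q ∷ qs) = construct-resp-≈T c q ∷ constructs-resp-≈T {G = G} cs qs

construct-resp-≈H : ∀ {G G' : Hyp n} {T} → G ≈H G' → Construct G T → Construct G' T
constructs-resp-≈H : ∀ {G G' : Hyp n} {Ks Ts} → G ≈H G' → Pointwise (ConstructOn G) Ks Ts → Pointwise (ConstructOn G') Ks Ts
construct-resp-≈H {G' = G'} q (whole ne) =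
  subst (λ S → Construct G' (node S [])) (sym (≈V q)) (whole (subst Nonempty (≈V q) ne))
construct-resp-≈H q (root ne ys yn l pw) =
  root ne (λ i → ∈≡ (≈V q) (ys i)) (λ e → yn (Eq.trans e (sym (≈V q)))) (leads-resp-≈H q l) (constructs-resp-≈H q pw)
constructs-resp-≈H q [] = []
constructs-resp-≈H q (c ∷ cs) = construct-resp-≈H (≈restrict _ q) c ∷ constructs-resp-≈H q cs

select-constructs : ∀ {G : Hyp n} {L Hs Ts} → Pointwise (ConstructOn G) Hs Ts →
                    Pointwise (ConstructOn (restrict G L)) (select-keys L Hs Ts) (select L (zip Hs Ts))
select-constructs {G = G} {L} cT = pw-build (select-pointwise {K = L} cT) λ m →
  let (m' , kl) = select-keys⁻ m in construct-resp-≈H (≈sym (restrict-restrict G kl)) (pw∈ cT m')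

target : Subset n → List (Subset n) → List (Tree n) → Subset n → Tree n
target X Hs Ts K = brace (K ∩ X) (select K (zip Hs Ts))

brace-node : ∀ {L : Subset n} ts → Nonempty L → brace L ts ≡ node L ts
brace-node [] ne = refl
brace-node {L = L} (t ∷ []) ne with nonempty? L
... | yes _ = refl
... | no ¬ne = ⊥-elim (¬ne ne)
brace-node (t ∷ t' ∷ ts) ne = refl

brace-⊥ : ∀ (t : Tree n) → brace ⊥ (t ∷ []) ≡ t
brace-⊥ {n} t with nonempty? (⊥ {n})
... | yes (x , ix) = ⊥-elim (∉⊥ ix)
... | no _ = refl

target-component : ∀ {G : Hyp n} {X Hs Ts K T} → Leads G X Hs → (K , T) ∈L zip Hs Ts → target X Hs Ts K ≡ T
target-component {X = X} {K = K} {T} l m =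
  Eq.trans (cong₂ brace K∩X≡⊥ (select-one uniq (λ mH s → sub⇒eq (zip∈ˡ m) mH s) m)) (brace-⊥ T)
  where
  open LeadsFacts l
  K∩X≡⊥ : K ∩ X ≡ ⊥
  K∩X≡⊥ = empty≡ λ i → let (a , b) = x∈p∩q⁻ K X i in notY (zip∈ˡ m) a b

target-node : ∀ {X : Subset n} Hs Ts {K} → Nonempty (K ∩ X) → target X Hs Ts K ≡ node (K ∩ X) (select K (zip Hs Ts))
target-node Hs Ts ne = brace-node _ ne

leads-select : ∀ (G : Hyp n) {Z X L Hs Ts} → Z ⊆ X → IsComponent (restrict G (V G ─ Z)) L → Leads G X Hs →
               Pointwise (ConstructOn G) Hs Ts → Leads (restrict G L) (L ∩ X) (select-keys L Hs Ts)
leads-select G {Z} {X} {L} {Hs} {Ts} zx cL lX cT =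
  leads-inside G Z X L Hs (select-keys L Hs Ts) zx cL lX (select-keys-unique cT (LeadsFacts.uniq lX)) (select-keys∈ cT)

target-restrict : ∀ {X L K : Subset n} {Hs Ts} → K ⊆ L →
                  target X Hs Ts K ≡ target (L ∩ X) (select-keys L Hs Ts) (select L (zip Hs Ts)) K
target-restrict {X = X} {L} {K} {Hs} {Ts} kl = cong₂ brace K∩X (sym (Eq.trans (cong (select K) (zip-select L Hs Ts)) (select-select-pairs kl (zip Hs Ts))))
  where
  K∩X : K ∩ X ≡ K ∩ (L ∩ X)
  K∩X = ⊆-antisym (λ i → let (a , b) = x∈p∩q⁻ K X i in ∈∩⁺ a (∈∩⁺ (kl a) b))
                  (λ i → let (a , b) = x∈p∩q⁻ K (L ∩ X) i in ∈∩⁺ a (p∩q⊆q L X b))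

-- for Y ⊆ X and a component K of 𝐇 ∖ Y, the target of K is a construct of 𝐊:
-- either K avoids X and is one of the Hᵢ, or it is (K∩X){Tᵢ : Hᵢ ⊆ K}
target-construct : ∀ {G : Hyp n} {X Hs Ts Y K} → Leads G X Hs → Pointwise (ConstructOn G) Hs Ts →
                   Y ⊆ X → IsComponent (restrict G (V G ─ Y)) K → Construct (restrict G K) (target X Hs Ts K)
target-construct {G = G} {X} {Hs} {Ts} {Y} {K} lX cT yx cK with nonempty? (K ∩ X)
... | no ¬ne =
  let mK = LeadsFacts.mem lX (component-shrink G Y X K yx cK (λ i j → ¬ne (_ , ∈∩⁺ i j)))
      (T , m) = pw∈ˡ cT mK
  in subst (Construct (restrict G K)) (sym (target-component lX m)) (pw∈ cT m)
... | yes ne =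
  subst (Construct (restrict G K)) (sym (target-node Hs Ts ne))
    (construct-node ne (p∩q⊆p K X) (leads-select G yx cK lX cT) (select-constructs {G = G} {L = K} cT))

-- ≤ ⊆ ≤₂

Below₂ : Hyp n → Subset n → List (Subset n) → List (Tree n) → List (Subset n) → List (Tree n) → Set
Below₂ G X Hs Ts Ks Ss = Pointwise (λ K S → S ≤₂[ restrict G K ] target X Hs Ts K) Ks Ss

≤₂-resp-≈H : ∀ {G G' : Hyp n} {S T} → G ≈H G' → S ≤₂[ G ] T → S ≤₂[ G' ] T
≤₂s-resp-≈H : ∀ {G G' : Hyp n} {Ks Ss X Hs Ts} → G ≈H G' → Below₂ G X Hs Ts Ks Ss → Below₂ G' X Hs Ts Ks Ss
≤₂-resp-≈H {G' = G'} q base₂ = subst (λ S → node S [] ≤₂[ G' ] node S []) (sym (≈V q)) base₂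
≤₂-resp-≈H q (step₂ {X = X} {Hs = Hs} {Ts = Ts} nY nX yx xv lY lX cS cT p) =
  step₂ nY nX yx (λ i → ∈≡ (≈V q) (xv i)) (leads-resp-≈H q lY) (leads-resp-≈H q lX)
        (constructs-resp-≈H q cS) (constructs-resp-≈H q cT) (≤₂s-resp-≈H {X = X} {Hs = Hs} {Ts = Ts} q p)
≤₂s-resp-≈H q [] = []
≤₂s-resp-≈H {X = X} {Hs} {Ts} q (d ∷ ds) = ≤₂-resp-≈H (≈restrict _ q) d ∷ ≤₂s-resp-≈H {X = X} {Hs = Hs} {Ts = Ts} q ds

-- reflexivity: every child of node Y is its own target
≤₂-refl : ∀ {G : Hyp n} {S} → Construct G S → S ≤₂[ G ] S
≤₂-refls : ∀ {G : Hyp n} {Y Ks Ss Ks₀ Ss₀} → Leads G Y Ks → Pointwise (ConstructOn G) Ks₀ Ss₀ →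
           (∀ {a b} → (a , b) ∈L zip Ks₀ Ss₀ → (a , b) ∈L zip Ks Ss) → Below₂ G Y Ks Ss Ks₀ Ss₀
≤₂-refl (whole ne) = base₂
≤₂-refl (root ne ys yn l pw) = step₂ ne ne (λ i → i) ys l l pw pw (≤₂-refls l pw (λ m → m))
≤₂-refls l [] emb = []
≤₂-refls l (c ∷ cs) emb =
  subst (_ ≤₂[ _ ]_) (sym (target-component l (emb (here refl)))) (≤₂-refl c) ∷ ≤₂-refls l cs (emb ∘ there)

-- Given a ≤₂-step Y(Ss) ≤₂ X(Ts) and Z ⊆ Y,
-- for every component L of 𝐇 ∖ Z the targets w.r.t. Y and X satisfy
--   (L∩Y){Sⱼ : Kⱼ ⊆ L}  ≤₂  (L∩X){Tᵢ : Hᵢ ⊆ L}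
-- (a single child when L avoids Y, otherwise the restricted ≤₂-step).
≤₂-restrict : ∀ {G : Hyp n} {Z Y X L Ks Ss Hs Ts} → Z ⊆ Y → Y ⊆ X → IsComponent (restrict G (V G ─ Z)) L →
  Leads G Y Ks → Leads G X Hs → Pointwise (ConstructOn G) Ks Ss → Pointwise (ConstructOn G) Hs Ts →
  Below₂ G X Hs Ts Ks Ss → target Y Ks Ss L ≤₂[ restrict G L ] target X Hs Ts L
≤₂-restrict {G = G} {Z} {Y} {X} {L} {Ks} {Ss} {Hs} {Ts} zy yx cL lY lX cS cT pS with nonempty? (L ∩ Y)
... | no ¬ne =
  let mL = LeadsFacts.mem lY (component-shrink G Z Y L zy cL (λ i j → ¬ne (_ , ∈∩⁺ i j)))
      (S , m) = pw∈ˡ cS mL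
  in subst (_≤₂[ restrict G L ] _) (sym (target-component lY m)) (pw∈ pS m)
... | yes ne =
  subst₂ (_≤₂[ restrict G L ]_) (sym (target-node Ks Ss ne)) (sym (target-node Hs Ts neX))
    (step₂ ne neX L∩Y⊆L∩X (p∩q⊆p L X) (leads-select G zy cL lY cS) (leads-select G (yx ∘ zy) cL lX cT)
           (select-constructs {G = G} {L = L} cS) (select-constructs {G = G} {L = L} cT) below)
  where
  L∩Y⊆L∩X : L ∩ Y ⊆ L ∩ X
  L∩Y⊆L∩X i = let (a , b) = x∈p∩q⁻ L Y i in ∈∩⁺ a (yx b)
  neX : Nonempty (L ∩ X)
  neX = proj₁ ne , L∩Y⊆L∩X (proj₂ ne)
  below : Below₂ (restrict G L) (L ∩ X) (select-keys L Hs Ts) (select L (zip Hs Ts)) (select-keys L Ks Ss) (select L (zip Ks Ss))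
  below = pw-build (select-pointwise {K = L} cS) λ {K} m → let (m' , kl) = select-keys⁻ m in
    ≤₂-resp-≈H (≈sym (restrict-restrict G kl)) (subst (_ ≤₂[ restrict G K ]_) (target-restrict {X = X} {L} {K} {Hs} {Ts} kl) (pw∈ pS m'))

≤₂-trans : ∀ {G : Hyp n} {U S T} → U ≤₂[ G ] S → S ≤₂[ G ] T → U ≤₂[ G ] T
≤₂-trans-children : ∀ {G : Hyp n} {Z Y X Ks Ss Hs Ts Ls₀ Us₀} → Z ⊆ Y → Y ⊆ X →
  (∀ {L} → L ∈L Ls₀ → IsComponent (restrict G (V G ─ Z)) L) → Leads G Y Ks → Leads G X Hs →
  Pointwise (ConstructOn G) Ks Ss → Pointwise (ConstructOn G) Hs Ts →
  Below₂ G X Hs Ts Ks Ss → Below₂ G Y Ks Ss Ls₀ Us₀ → Below₂ G X Hs Ts Ls₀ Us₀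
≤₂-trans base₂ d = d
≤₂-trans d@(step₂ _ _ _ _ _ _ _ _ _) base₂ = d
≤₂-trans (step₂ nZ nY zy yV lZ lY cU cS pU) (step₂ nY' nX yx xV lY' lX cS' cT pS)
  with leads-unique lY lY' cS cS'
... | refl = step₂ nZ nX (yx ∘ zy) xV lZ lX cU cT (≤₂-trans-children zy yx (LeadsFacts.comp lZ) lY lX cS cT pS pU)
≤₂-trans-children zy yx cl lY lX cS cT pS [] = []
≤₂-trans-children zy yx cl lY lX cS cT pS (u ∷ us) =
  ≤₂-trans u (≤₂-restrict zy yx (cl (here refl)) lY lX cS cT pS) ∷ ≤₂-trans-children zy yx (cl ∘ there) lY lX cS cT pS us

merge-data : ∀ {G : Hyp n} {Y K₁ Ks X H₁s T₁s Ts} → Y ⊆ V G → Leads G Y (K₁ ∷ Ks) → X ⊆ K₁ →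
  Leads (restrict G K₁) X H₁s → Pointwise (ConstructOn (restrict G K₁)) H₁s T₁s → Pointwise (ConstructOn G) Ks Ts →
  (Y ∪ X ⊆ V G) × Pointwise (ConstructOn G) (H₁s ++ Ks) (T₁s ++ Ts)
merge-data {G = G} {Y} {X = X} yv L xk L₁ cT₁ cs =
  (λ i → [ yv , (λ j → LeadsFacts.subV L (here refl) (xk j)) ] (x∈p∪q⁻ Y X i)) ,
  PW.++⁺ (pw-build cT₁ (λ m → construct-resp-≈H (restrict-restrict G (LeadsFacts.subV L₁ (zip∈ˡ m))) (pw∈ cT₁ m))) cs

-- After merging X(T₁s) into the root Y, the target of K₁ is X(T₁s) again:
-- K₁ ∩ (Y∪X) = X, and exactly the T₁s hang below K₁.
merged-target : ∀ {G : Hyp n} {Y K₁ Ks X H₁s T₁s Ts} → Leads G Y (K₁ ∷ Ks) → Nonempty X → X ⊆ K₁ →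
  Leads (restrict G K₁) X H₁s → Pointwise (ConstructOn (restrict G K₁)) H₁s T₁s → Pointwise (ConstructOn G) Ks Ts →
  target (Y ∪ X) (H₁s ++ Ks) (T₁s ++ Ts) K₁ ≡ node X T₁s
merged-target {Y = Y} {K₁} {Ks} {X} {H₁s} {T₁s} {Ts} L nX xk L₁ cT₁ cs =
  Eq.trans (cong₂ brace K₁∩YX select-K₁) (brace-node T₁s nX)
  where
  open LeadsFacts L
  H₁⊆K₁ : ∀ {K T} → (K , T) ∈L zip H₁s T₁s → K ⊆ K₁
  H₁⊆K₁ m = LeadsFacts.subV L₁ (zip∈ˡ m)
  K₁∩YX : K₁ ∩ (Y ∪ X) ≡ X
  K₁∩YX = ⊆-antisym
    (λ i → let (a , b) = x∈p∩q⁻ K₁ (Y ∪ X) i in [ (λ y → ⊥-elim (notY (here refl) a y)) , (λ x → x) ] (x∈p∪q⁻ Y X b))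
    (λ i → ∈∩⁺ (xk i) (∈∪ʳ Y i))
  -- the other components are disjoint from K₁, so none of the Ts is selected
  none-below : select K₁ (zip Ks Ts) ≡ []
  none-below = select-none (λ m s → unique-head uniq (subst (_∈L Ks) (sub⇒eq (here refl) (there (zip∈ˡ m)) s) (zip∈ˡ m)))
  select-K₁ : select K₁ (zip (H₁s ++ Ks) (T₁s ++ Ts)) ≡ T₁s
  select-K₁ = begin
    select K₁ (zip (H₁s ++ Ks) (T₁s ++ Ts))            ≡⟨ cong (select K₁) (zip-++ Ks Ts cT₁) ⟩
    select K₁ (zip H₁s T₁s ++ zip Ks Ts)               ≡⟨ select-++ K₁ (zip H₁s T₁s) (zip Ks Ts) ⟩
    select K₁ (zip H₁s T₁s) ++ select K₁ (zip Ks Ts)   ≡⟨ cong₂ _++_ (Eq.trans (select-all H₁⊆K₁) (pw-snd cT₁)) none-below ⟩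
    T₁s ++ []                                          ≡⟨ ++-identityʳ T₁s ⟩
    T₁s                                                ∎
    where open ≡-Reasoning

-- the merge generator of ≤ is a single ≤₂-step: the merged child X(T₁s)
-- is the target of K₁, all other children are their own targets
≤₂-merge : ∀ {G : Hyp n} {Y K₁ Ks X H₁s T₁s Ts} → Nonempty Y → Y ⊆ V G → Leads G Y (K₁ ∷ Ks) → Nonempty X → X ⊆ K₁ →
  Leads (restrict G K₁) X H₁s → Pointwise (ConstructOn (restrict G K₁)) H₁s T₁s → Pointwise (ConstructOn G) Ks Ts →
  node Y (node X T₁s ∷ Ts) ≤₂[ G ] node (Y ∪ X) (T₁s ++ Ts)
≤₂-merge {G = G} {Y} {K₁} {Ks} {X} {H₁s} {T₁s} {Ts} nY yv L nX xk L₁ cT₁ cs =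
  step₂ nY (proj₁ nY , p⊆p∪q X (proj₂ nY)) (p⊆p∪q X) (proj₁ data′) L L' (c₁ ∷ cs) (proj₂ data′) (merged ∷ others)
  where
  L' = leads-merge G Y X K₁ Ks H₁s L xk L₁
  data′ = merge-data yv L xk L₁ cT₁ cs
  c₁ : Construct (restrict G K₁) (node X T₁s)
  c₁ = construct-node nX xk L₁ cT₁
  merged : node X T₁s ≤₂[ restrict G K₁ ] target (Y ∪ X) (H₁s ++ Ks) (T₁s ++ Ts) K₁
  merged = subst (node X T₁s ≤₂[ restrict G K₁ ]_) (sym (merged-target L nX xk L₁ cT₁ cs)) (≤₂-refl c₁)
  others : Below₂ G (Y ∪ X) (H₁s ++ Ks) (T₁s ++ Ts) Ks Ts
  others = pw-build cs (λ m → subst (_ ≤₂[ _ ]_)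
             (sym (target-component L' (subst (λ zs → (_ , _) ∈L zs) (sym (zip-++ Ks Ts cT₁)) (∈-++⁺ʳ (zip H₁s T₁s) m))))
             (≤₂-refl (pw∈ cs m)))

≤₂-cong : ∀ {G : Hyp n} {Y K₁ Ks T₁ T₁' Ts} → Nonempty Y → Y ⊆ V G → Leads G Y (K₁ ∷ Ks) → Pointwise (ConstructOn G) Ks Ts →
  Construct (restrict G K₁) T₁ → Construct (restrict G K₁) T₁' → T₁ ≤₂[ restrict G K₁ ] T₁' →
  node Y (T₁ ∷ Ts) ≤₂[ G ] node Y (T₁' ∷ Ts)
≤₂-cong {T₁ = T₁} nY yv L cs c c' d =
  step₂ nY nY (λ i → i) yv L L (c ∷ cs) (c' ∷ cs)
    (subst (T₁ ≤₂[ _ ]_) (sym (target-component L (here refl))) d ∷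
     pw-build cs (λ m → subst (_ ≤₂[ _ ]_) (sym (target-component L (there m))) (≤₂-refl (pw∈ cs m))))

-- reordering children (≈T) is ≤₂: permute the list of components, then
-- recurse into the children
≈⇒≤₂ : ∀ {G : Hyp n} {S T} → Construct G S → S ≈T T → S ≤₂[ G ] T
≈⇒≤₂-children : ∀ {G : Hyp n} {Y Ks' ts Ks₀ us₀ ts₀} → Leads G Y Ks' → Pointwise (ConstructOn G) Ks₀ us₀ →
  Pointwise _≈T_ us₀ ts₀ → (∀ {a b} → (a , b) ∈L zip Ks₀ ts₀ → (a , b) ∈L zip Ks' ts) → Below₂ G Y Ks' ts Ks₀ us₀
≈⇒≤₂ (whole ne) (node≈ p pw) with ↭-empty-inv (↭-sym p)
... | refl with pw
... | [] = base₂
≈⇒≤₂ {G = G} (root ne ys yn l cs) (node≈ p pw) = ≤₂-trans permute recurse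
  where
  aligned = perm-align cs p
  cs' = proj₁ (proj₂ (proj₂ aligned))
  l' = components-resp-↭ l (proj₁ (proj₂ aligned))
  zip↭ = proj₂ (proj₂ (proj₂ aligned))
  permute = step₂ ne ne (λ i → i) ys l l' cs cs'
              (pw-build cs (λ m → subst (_ ≤₂[ _ ]_) (sym (target-component l' (∈-resp-↭ zip↭ m))) (≤₂-refl (pw∈ cs m))))
  recurse = step₂ ne ne (λ i → i) ys l' l' cs' (constructs-resp-≈T {G = G} cs' pw) (≈⇒≤₂-children l' cs' pw (λ m → m))
≈⇒≤₂-children l [] [] emb = []
≈⇒≤₂-children l (c ∷ cs) (q ∷ qs) emb =
  subst (_ ≤₂[ _ ]_) (sym (target-component l (emb (here refl)))) (≈⇒≤₂ c q) ∷ ≈⇒≤₂-children l cs qs (emb ∘ there)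

≤-constructs : ∀ {G : Hyp n} {S T} → S ≤[ G ] T → Construct G S × Construct G T
≤-constructs (refl≤ c e) = c , construct-resp-≈T c e
≤-constructs (trans≤ a b) = proj₁ (≤-constructs a) , proj₂ (≤-constructs b)
≤-constructs {G = G} (merge {Y = Y} {K₁ = K₁} {Ks = Ks} {X = X} {H₁s = H₁s} nY yv yn L nX xk L₁ cT₁ cs) =
  root nY yv yn L (construct-node nX xk L₁ cT₁ ∷ cs) ,
  let (YX⊆V , children) = merge-data yv L xk L₁ cT₁ cs
  in construct-node (proj₁ nY , p⊆p∪q X (proj₂ nY)) YX⊆V (leads-merge G Y X K₁ Ks H₁s L xk L₁) children
≤-constructs (cong≤ nY yv yn L cs d) =
  root nY yv yn L (proj₁ (≤-constructs d) ∷ cs) , root nY yv yn L (proj₂ (≤-constructs d) ∷ cs)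

≤⇒≤₂ : ∀ {G : Hyp n} {S T} → S ≤[ G ] T → S ≤₂[ G ] T
≤⇒≤₂ (refl≤ c e) = ≈⇒≤₂ c e
≤⇒≤₂ (trans≤ a b) = ≤₂-trans (≤⇒≤₂ a) (≤⇒≤₂ b)
≤⇒≤₂ (merge nY yv yn L nX xk L₁ cT₁ cs) = ≤₂-merge nY yv L nX xk L₁ cT₁ cs
≤⇒≤₂ (cong≤ nY yv yn L cs d) = let (c , c') = ≤-constructs d in ≤₂-cong nY yv L cs c c' (≤⇒≤₂ d)

-- ≤₃ ⊆ ≤

≤-resp-≈H : ∀ {G G' : Hyp n} {S T} → G ≈H G' → S ≤[ G ] T → S ≤[ G' ] T
≤-resp-≈H q (refl≤ c e) = refl≤ (construct-resp-≈H q c) e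
≤-resp-≈H q (trans≤ a b) = trans≤ (≤-resp-≈H q a) (≤-resp-≈H q b)
≤-resp-≈H q (merge {K₁ = K₁} nY yv yn L nX xk L₁ cT₁ cs) =
  merge nY (λ i → ∈≡ (≈V q) (yv i)) (λ e → yn (Eq.trans e (sym (≈V q)))) (leads-resp-≈H q L) nX xk
        (leads-resp-≈H (≈restrict K₁ q) L₁) (constructs-resp-≈H (≈restrict K₁ q) cT₁) (constructs-resp-≈H q cs)
≤-resp-≈H q (cong≤ {K₁ = K₁} nY yv yn L cs d) =
  cong≤ nY (λ i → ∈≡ (≈V q) (yv i)) (λ e → yn (Eq.trans e (sym (≈V q)))) (leads-resp-≈H q L)
        (constructs-resp-≈H q cs) (≤-resp-≈H (≈restrict K₁ q) d)

++∷≢[] : ∀ {A : Set} (xs : List A) {y ys} → xs ++ y ∷ ys ≢ []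
++∷≢[] [] ()
++∷≢[] (x ∷ xs) ()

-- congruence of ≤ at an arbitrary child (the generator acts on the first one)
≤-cong-at : ∀ {G : Hyp n} {Y Ka K Kc As R B Cs} → Nonempty Y → Y ⊆ V G → Leads G Y (Ka ++ K ∷ Kc) →
  Pointwise (ConstructOn G) Ka As → Pointwise (ConstructOn G) Kc Cs → R ≤[ restrict G K ] B →
  node Y (As ++ R ∷ Cs) ≤[ G ] node Y (As ++ B ∷ Cs)
≤-cong-at {G = G} {Y} {Ka} {K} {Kc} {As} {R} {B} {Cs} nY yv L ca cc d =
  trans≤ (refl≤ before (node≈ (shift R As Cs) (≈T-refls _)))
    (trans≤ (cong≤ nY yv yn L' (PW.++⁺ ca cc) d)
      (refl≤ after (node≈ (↭-sym (shift B As Cs)) (≈T-refls _))))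
  where
  yn = leads-≢V L (++∷≢[] Ka)
  L' = components-resp-↭ L (shift K Ka Kc)
  before = root nY yv yn L (PW.++⁺ ca (proj₁ (≤-constructs d) ∷ cc))
  after = root nY yv yn L' (proj₂ (≤-constructs d) ∷ PW.++⁺ ca cc)

≤-cong-all : ∀ {G : Hyp n} {Y} (f : Subset n → Tree n) {Ka As Ks Rs} → Nonempty Y → Y ⊆ V G → Leads G Y (Ka ++ Ks) →
  Pointwise (ConstructOn G) Ka As → Pointwise (λ K R → R ≤[ restrict G K ] f K) Ks Rs →
  node Y (As ++ Rs) ≤[ G ] node Y (As ++ map f Ks)
≤-cong-all f {Ka} {As} nY yv L ca [] = refl≤ (construct-node nY yv L (PW.++⁺ ca [])) (≈T-refl _)
≤-cong-all {G = G} {Y} f {Ka} {As} {K ∷ Ks} {R ∷ Rs} nY yv L ca (d ∷ ds) =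
  trans≤ (≤-cong-at nY yv L ca (PW.map (proj₁ ∘ ≤-constructs) ds) d)
    (subst₂ (_≤[ G ]_) (cong (node Y) (++-assoc As (f K ∷ []) Rs)) (cong (node Y) (++-assoc As (f K ∷ []) (map f Ks)))
      (≤-cong-all f nY yv L' (PW.++⁺ ca (proj₂ (≤-constructs d) ∷ [])) ds))
  where
  L' = subst (Leads G Y) (sym (++-assoc Ka (K ∷ []) Ks)) L

-- Fix a node X(T₁,…,Tₙ) of 𝐇.  For ∅ ≠ Y ⊆ X with 𝐇,Y ⇝ Ks,
--   Y{ target K : K ∈ Ks }  ≤  X(T₁,…,Tₙ):
-- repeatedly merge a child whose component K meets X (its target is the node
-- (K∩X)(Tᵢ : Hᵢ ⊆ K)) into the root; when none is left, Y = X and the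
-- children are a permutation of the Tᵢ.  Induction on X ∖ Y.
module Collapse {G : Hyp n} {X : Subset n} {Hs Ts} (xV : X ⊆ V G) (lX : Leads G X Hs)
                (cT : Pointwise (ConstructOn G) Hs Ts) where
  tgt : Subset n → Tree n
  tgt = target X Hs Ts

  map-target : ∀ {Hs₀ Ts₀} → Pointwise (λ _ _ → ⊤₀) Hs₀ Ts₀ →
               (∀ {H T} → (H , T) ∈L zip Hs₀ Ts₀ → (H , T) ∈L zip Hs Ts) → map tgt Hs₀ ≡ Ts₀
  map-target [] emb = refl
  map-target (_ ∷ p) emb = cong₂ _∷_ (target-component lX (emb (here refl))) (map-target p (emb ∘ there))

  targets-construct : ∀ {Y Ks} → Y ⊆ X → Leads G Y Ks → Pointwise (ConstructOn G) Ks (map tgt Ks)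
  targets-construct yx L = pw-map-self tgt (λ mK → target-construct lX cT yx (LeadsFacts.comp L mK))

  -- no remaining component meets X: then Y = X and we have reordered the Tᵢ
  collapse-done : ∀ {Y Ks} → Nonempty Y → Y ⊆ X → Leads G Y Ks → ¬ Any (λ K → Nonempty (K ∩ X)) Ks →
                  node Y (map tgt Ks) ≤[ G ] node X Ts
  collapse-done {Y} {Ks} nY yx L none =
    subst (λ Z → node Y (map tgt Ks) ≤[ G ] node Z Ts) Y≡X
      (refl≤ (construct-node nY (xV ∘ yx) L (targets-construct yx L))
             (node≈ (subst (map tgt Ks ↭_) (map-target (PW.map (λ _ → tt) cT) (λ m → m)) (PermP.map⁺ tgt Ks↭Hs))
                    (≈T-refls _)))
    where
    X⊆Y : X ⊆ Y
    X⊆Y {x} i with x ∈? Y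
    ... | yes j = j
    ... | no j = let (K , mK , xK) = LeadsFacts.coverY L (xV i) j in ⊥-elim (none (lose mK (x , ∈∩⁺ xK i)))
    Y≡X : Y ≡ X
    Y≡X = ⊆-antisym yx X⊆Y
    Ks↭Hs : Ks ↭ Hs
    Ks↭Hs = components-↭ (subst (λ Z → Leads G Z Ks) Y≡X L) lX

  collapse : ∀ {Y Ks} → Acc _⊂_ (X ─ Y) → Nonempty Y → Y ⊆ X → Leads G Y Ks → node Y (map tgt Ks) ≤[ G ] node X Ts
  collapse {Y} {Ks} (acc rs) nY yx L with Any.any? (λ K → nonempty? (K ∩ X)) Ks
  ... | no none = collapse-done nY yx L none
  ... | yes some with find some
  ... | K , mK , neKX with ∈-∃++ mK
  ... | Ka , Kc , refl = trans≤ reorder (trans≤ merge-K (subst (λ Z → node Y' Z ≤[ G ] node X Ts) (sym children≡) rest))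
    where
    L' = components-resp-↭ L (shift K Ka Kc)
    H₁s = select-keys K Hs Ts
    T₁s = select K (zip Hs Ts)
    K∩X⊆K = p∩q⊆p K X
    lK : Leads (restrict G K) (K ∩ X) H₁s
    lK = leads-select G yx (LeadsFacts.comp L' (here refl)) lX cT
    -- bring the child of K to the front; its target is the node (K∩X)(T₁s)
    reorder : node Y (map tgt (Ka ++ K ∷ Kc)) ≤[ G ] node Y (node (K ∩ X) T₁s ∷ map tgt (Ka ++ Kc))
    reorder = subst (λ Z → node Y (map tgt (Ka ++ K ∷ Kc)) ≤[ G ] node Y (Z ∷ map tgt (Ka ++ Kc))) (target-node Hs Ts neKX)
                (refl≤ (construct-node nY (xV ∘ yx) L (targets-construct yx L)) (node≈ (PermP.map⁺ tgt (shift K Ka Kc)) (≈T-refls _)))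
    Y' = Y ∪ (K ∩ X)
    merge-K : node Y (node (K ∩ X) T₁s ∷ map tgt (Ka ++ Kc)) ≤[ G ] node Y' (T₁s ++ map tgt (Ka ++ Kc))
    merge-K = merge nY (xV ∘ yx) (leads-≢V L (++∷≢[] Ka)) L' neKX K∩X⊆K lK (select-constructs {G = G} {L = K} cT)
                (pw-map-self tgt (λ mK' → target-construct lX cT yx (LeadsFacts.comp L' (there mK'))))
    children≡ : T₁s ++ map tgt (Ka ++ Kc) ≡ map tgt (H₁s ++ Ka ++ Kc)
    children≡ = sym (Eq.trans (map-++ tgt H₁s (Ka ++ Kc))
                  (cong (_++ map tgt (Ka ++ Kc)) (map-target (PW.map (λ _ → tt) (select-constructs {G = G} {L = K} cT))
                                                   (λ m → proj₁ (select-keys⁻ m)))))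
    Y'⊆X : Y' ⊆ X
    Y'⊆X i = [ yx , p∩q⊆q K X ] (x∈p∪q⁻ Y (K ∩ X) i)
    -- the new root is strictly bigger: it contains a point of K ∩ X ∌ Y
    smaller : X ─ Y' ⊂ X ─ Y
    smaller = ─-anti X (p⊆p∪q (K ∩ X)) ,
              proj₁ neKX , x∈p∧x∉q⇒x∈p─q (p∩q⊆q K X (proj₂ neKX)) (LeadsFacts.notY L' (here refl) (K∩X⊆K (proj₂ neKX))) ,
              (λ i → proj₂ (∈─⁻ X Y' i) (∈∪ʳ Y (proj₂ neKX)))
    rest : node Y' (map tgt (H₁s ++ Ka ++ Kc)) ≤[ G ] node X Ts
    rest = collapse (rs smaller) (proj₁ nY , p⊆p∪q (K ∩ X) (proj₂ nY)) Y'⊆X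
             (leads-merge G Y (K ∩ X) K (Ka ++ Kc) H₁s L' K∩X⊆K lK)

-- every construct is below the one-node construct H (collapse with X = H)
≤-top : ∀ {G : Hyp n} {S} → Construct G S → S ≤[ G ] node (V G) []
≤-top-children : ∀ {G : Hyp n} {Ks₀ Ss₀} → Pointwise (ConstructOn G) Ks₀ Ss₀ → (∀ {K} → K ∈L Ks₀ → K ⊆ V G) →
  Pointwise (λ K S → S ≤[ restrict G K ] target (V G) [] [] K) Ks₀ Ss₀
≤-top (whole ne) = refl≤ (whole ne) (≈T-refl _)
≤-top {G = G} (root {Y = Y} ne ys yn l cs) =
  trans≤ (≤-cong-all (target (V G) [] []) {Ka = []} {As = []} ne ys l [] (≤-top-children cs (LeadsFacts.subV l)))
         (Collapse.collapse (λ i → i) leads-nil [] (⊂-wellFounded _) ne ys l)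
≤-top-children [] f = []
≤-top-children {G = G} (_∷_ {x = K} {y = S} c cs) f =
  subst (λ Z → S ≤[ restrict G K ] Z) K≡K∩V (≤-top c) ∷ ≤-top-children {G = G} cs (f ∘ there)
  where
  K≡K∩V : node K [] ≡ brace (K ∩ V G) []
  K≡K∩V = cong (λ Z → node Z []) (⊆-antisym (λ i → ∈∩⁺ i (f (here refl) i)) (p∩q⊆p K (V G)))

labels⊆V : ∀ {G : Hyp n} {P} → PartialConstruct G P → labels P ⊆ V G
labelsL⊆V : ∀ {G : Hyp n} {Ks Ps} → (∀ {K} → K ∈L Ks → K ⊆ V G) →
  Pointwise (λ K P → PartialConstruct (restrict G K) P) Ks Ps → labelsL Ps ⊆ V G
labels⊆V pΩ i = ⊥-elim (∉⊥ i)
labels⊆V {G = G} pwhole i = [ (λ j → j) , (λ j → ⊥-elim (∉⊥ j)) ] (x∈p∪q⁻ (V G) ⊥ i)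
labels⊆V (proot nX xV l ps) i = [ xV , labelsL⊆V (LeadsFacts.subV l) ps ] (x∈p∪q⁻ _ _ i)
labelsL⊆V f [] i = ⊥-elim (∉⊥ i)
labelsL⊆V f (p ∷ ps) i = [ (λ j → f (here refl) (labels⊆V p j)) , labelsL⊆V (f ∘ there) ps ] (x∈p∪q⁻ _ _ i)

labelsL⁻ : ∀ {Ps : List (PTree n)} {x} → x ∈ labelsL Ps → Σ _ λ P → P ∈L Ps × x ∈ labels P
labelsL⁻ {Ps = []} i = ⊥-elim (∉⊥ i)
labelsL⁻ {Ps = P ∷ Ps} i with x∈p∪q⁻ (labels P) (labelsL Ps) i
... | inj₁ j = P , here refl , j
... | inj₂ j = let (P' , m , k) = labelsL⁻ j in P' , there m , k

labelsL⁺ : ∀ {Ps : List (PTree n)} {P x} → P ∈L Ps → x ∈ labels P → x ∈ labelsL Ps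
labelsL⁺ {Ps = P ∷ Ps} (here refl) i = p⊆p∪q (labelsL Ps) i
labelsL⁺ {Ps = P ∷ Ps} (there m) i = ∈∪ʳ (labels P) (labelsL⁺ m i)

labels-child : ∀ {G : Hyp n} {X₁ X Ks Ps K P} → Leads G X₁ Ks →
  Pointwise (λ K P → PartialConstruct (restrict G K) P) Ks Ps → X₁ ∪ labelsL Ps ≡ X →
  (K , P) ∈L zip Ks Ps → labels P ≡ K ∩ X
labels-child {X₁ = X₁} {X} {Ks} {Ps} {K} {P} l pcs lab m = ⊆-antisym ⊆K∩X K∩X⊆
  where
  ⊆K∩X : labels P ⊆ K ∩ X
  ⊆K∩X i = ∈∩⁺ (labels⊆V (pw∈ pcs m) i) (∈≡ lab (∈∪ʳ X₁ (labelsL⁺ (zip∈ʳ m) i)))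
  -- a point of K ∩ X is not in X₁, so it is a label of some child, which lives on K
  K∩X⊆ : K ∩ X ⊆ labels P
  K∩X⊆ {x} i with x∈p∩q⁻ K X i
  ... | a , b with x∈p∪q⁻ X₁ (labelsL Ps) (∈≡ (sym lab) b)
  ... | inj₁ x1 = ⊥-elim (LeadsFacts.notY l (zip∈ˡ m) a x1)
  ... | inj₂ l' with labelsL⁻ l'
  ... | P' , mP' , xP' with pw∈ʳ pcs mP'
  ... | K' , m' =
    let K'≡K = LeadsFacts.eqp l (zip∈ˡ m') (zip∈ˡ m) (labels⊆V (pw∈ pcs m') xP') a
        P'≡P = unique-key (LeadsFacts.uniq l) (subst (λ Z → (Z , P') ∈L zip Ks Ps) K'≡K m') m
    in subst (λ Q → x ∈ labels Q) P'≡P xP'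

Improves : Hyp n → List (Subset n × Tree n) → List (Subset n) → List (Tree n) → Set
Improves G σ Hs Ts = ∀ {K S T} → (K , S) ∈L σ → (K , T) ∈L zip Hs Ts → S ≤[ restrict G K ] T

-- Main lemma for ≤₃ ⊆ ≤: if ℙ spans X and σ improves the Tᵢ, then
--   ℙ[Ω_{Hᵢ} ← σ(Hᵢ)]  ≤  X(T₁,…,Tₙ).
-- Improve every child of the root X₁ of ℙ to its target (recursively), then collapse.
fill≤ : ∀ {G : Hyp n} {P X Hs Ts σ R} → PartialConstruct G P → labels P ≡ X → Nonempty X →
        Leads G X Hs → Pointwise (ConstructOn G) Hs Ts → Improves G σ Hs Ts → Fill σ P R → R ≤[ G ] node X Ts
fill≤-children : ∀ {G : Hyp n} {X₁ X Hs Ts σ Ks₀ Ps₀ Rs₀} → X₁ ⊆ X → Leads G X Hs → Pointwise (ConstructOn G) Hs Ts →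
  Improves G σ Hs Ts → (∀ {K} → K ∈L Ks₀ → IsComponent (restrict G (V G ─ X₁)) K) →
  (∀ {K P} → (K , P) ∈L zip Ks₀ Ps₀ → labels P ≡ K ∩ X) →
  Pointwise (λ K P → PartialConstruct (restrict G K) P) Ks₀ Ps₀ → Pointwise (Fill σ) Ps₀ Rs₀ →
  Pointwise (λ K R → R ≤[ restrict G K ] target X Hs Ts K) Ks₀ Rs₀
fill≤-child : ∀ {G : Hyp n} {X₁ X Hs Ts σ K P R} → X₁ ⊆ X → Leads G X Hs → Pointwise (ConstructOn G) Hs Ts →
  Improves G σ Hs Ts → IsComponent (restrict G (V G ─ X₁)) K → labels P ≡ K ∩ X → Nonempty (labels P) →
  PartialConstruct (restrict G K) P → Fill σ P R → R ≤[ restrict G K ] target X Hs Ts K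

fill≤ pΩ lab nX lX cT σh f = ⊥-elim (∉⊥ (∈≡ (sym lab) (proj₂ nX)))
fill≤ {G = G} {X = X} pwhole lab nX lX cT σh (fillNode []) with leads-⊇V (λ i → ∈≡ lab (p⊆p∪q ⊥ i)) lX
... | refl with cT
... | [] = subst (λ Z → node (V G) [] ≤[ G ] node Z []) V≡X (refl≤ (whole (proj₁ nX , ∈≡ (sym V≡X) (proj₂ nX))) (≈T-refl _))
  where
  V≡X : V G ≡ X
  V≡X = Eq.trans (sym (∪-identityʳ (V G))) lab
fill≤ {G = G} {X = X} {Hs} {Ts} (proot {X = X₁} nX₁ x₁V l pcs) lab nX lX cT σh (fillNode fs) =
  trans≤ (≤-cong-all (target X Hs Ts) {Ka = []} {As = []} nX₁ x₁V l []
           (fill≤-children X₁⊆X lX cT σh (LeadsFacts.comp l) (labels-child l pcs lab) pcs fs))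
         (Collapse.collapse X⊆V lX cT (⊂-wellFounded _) nX₁ X₁⊆X l)
  where
  X₁⊆X : X₁ ⊆ X
  X₁⊆X i = ∈≡ lab (p⊆p∪q _ i)
  X⊆V : X ⊆ V G
  X⊆V i = labels⊆V (proot nX₁ x₁V l pcs) (∈≡ (sym lab) i)

fill≤-children x₁X lX cT σh cK labj [] [] = []
-- an Ω-leaf: K avoids X, so K is one of the Hᵢ and σ improves Tᵢ directly
fill≤-children {G = G} {X₁} {X} x₁X lX cT σh cK labj (pΩ ∷ pcs) (fillΩ m ∷ fs) =
  subst (_ ≤[ _ ]_) (sym (target-component lX (proj₂ Tm))) (σh m (proj₂ Tm))
  ∷ fill≤-children x₁X lX cT σh (cK ∘ there) (labj ∘ there) pcs fs
  where
  mK = LeadsFacts.mem lX (component-shrink G X₁ X _ x₁X (cK (here refl))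
         (λ i j → ∉⊥ (∈≡ (sym (labj (here refl))) (∈∩⁺ i j))))
  Tm = pw∈ˡ cT mK
fill≤-children x₁X lX cT σh cK labj (pwhole ∷ pcs) (f ∷ fs) =
  fill≤-child x₁X lX cT σh (cK (here refl)) (labj (here refl)) ne pwhole f
  ∷ fill≤-children x₁X lX cT σh (cK ∘ there) (labj ∘ there) pcs fs
  where
  ne = let (x , ix) = Component.nonempty (cK (here refl)) in x , p⊆p∪q ⊥ ix
fill≤-children x₁X lX cT σh cK labj (pc@(proot nX' _ _ _) ∷ pcs) (f ∷ fs) =
  fill≤-child x₁X lX cT σh (cK (here refl)) (labj (here refl)) ne pc f
  ∷ fill≤-children x₁X lX cT σh (cK ∘ there) (labj ∘ there) pcs fs
  where
  ne = let (x , ix) = nX' in x , p⊆p∪q _ ix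

-- a non-Ω child spans K ∩ X ≠ ∅: apply fill≤ inside 𝐊 to the restricted data
fill≤-child {G = G} {X₁} {X} {Hs} {Ts} {σ} {K} {R = R} x₁X lX cT σh cK lab ne pc f =
  subst (R ≤[ restrict G K ]_) (sym (target-node Hs Ts neKX))
    (fill≤ pc lab neKX (leads-select G x₁X cK lX cT) (select-constructs {G = G} {L = K} cT) σh' f)
  where
  neKX : Nonempty (K ∩ X)
  neKX = proj₁ ne , ∈≡ lab (proj₂ ne)
  σh' : Improves (restrict G K) σ (select-keys K Hs Ts) (select K (zip Hs Ts))
  σh' m m' = let (m'' , k'k) = select-keys⁻ m' in ≤-resp-≈H (≈sym (restrict-restrict G k'k)) (σh m m'')

≤₃⇒≤ : ∀ {G : Hyp n} {S T} → S ≤₃[ G ] T → S ≤[ G ] T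
≤₃⇒≤-children : ∀ {G : Hyp n} {Hs ps} → Pointwise (λ K ST → proj₁ ST ≤₃[ restrict G K ] proj₂ ST) Hs ps →
  Pointwise (λ K ST → proj₁ ST ≤[ restrict G K ] proj₂ ST) Hs ps
≤₃⇒≤ (base₃ c) = ≤-top c
≤₃⇒≤ {G = G} (step₃ {Hs = Hs} {Ss = Ss} {Ts = Ts} nX (pc , lab) lX cS cT p3 fill) = fill≤ pc lab nX lX cT improves fill
  where
  improves : Improves G (zip Hs Ss) Hs Ts
  improves {K} {S} m m' =
    let (T' , m1 , m2) = zip3 cS cT m
    in subst (S ≤[ restrict G K ]_) (unique-key (LeadsFacts.uniq lX) m2 m') (pw∈ (≤₃⇒≤-children {G = G} p3) m1)
≤₃⇒≤-children [] = []
≤₃⇒≤-children {G = G} (d ∷ ds) = ≤₃⇒≤ d ∷ ≤₃⇒≤-children {G = G} ds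

-- ≤₂ ⊆ ≤₃

partial-resp-≈H : ∀ {G G' : Hyp n} {P} → G ≈H G' → PartialConstruct G P → PartialConstruct G' P
partials-resp-≈H : ∀ {G G' : Hyp n} {Ks Ps} → G ≈H G' → Pointwise (λ K P → PartialConstruct (restrict G K) P) Ks Ps →
  Pointwise (λ K P → PartialConstruct (restrict G' K) P) Ks Ps
partial-resp-≈H {G' = G'} q pΩ = subst (λ Z → PartialConstruct G' (Ω Z)) (sym (≈V q)) pΩ
partial-resp-≈H {G' = G'} q pwhole = subst (λ Z → PartialConstruct G' (pnode Z [])) (sym (≈V q)) pwhole
partial-resp-≈H q (proot nX xV l ps) = proot nX (λ i → ∈≡ (≈V q) (xV i)) (leads-resp-≈H q l) (partials-resp-≈H q ps)
partials-resp-≈H q [] = []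
partials-resp-≈H q (p ∷ ps) = partial-resp-≈H (≈restrict _ q) p ∷ partials-resp-≈H q ps

≤₃-resp-≈H : ∀ {G G' : Hyp n} {S T} → G ≈H G' → S ≤₃[ G ] T → S ≤₃[ G' ] T
≤₃s-resp-≈H : ∀ {G G' : Hyp n} {Hs ps} → G ≈H G' → Pointwise (λ K ST → proj₁ ST ≤₃[ restrict G K ] proj₂ ST) Hs ps →
  Pointwise (λ K ST → proj₁ ST ≤₃[ restrict G' K ] proj₂ ST) Hs ps
≤₃-resp-≈H {G' = G'} {S = S} q (base₃ c) = subst (λ Z → S ≤₃[ G' ] node Z []) (sym (≈V q)) (base₃ (construct-resp-≈H q c))
≤₃-resp-≈H q (step₃ nX (pc , lab) lX cS cT p f) =
  step₃ nX (partial-resp-≈H q pc , lab) (leads-resp-≈H q lX) (constructs-resp-≈H q cS) (constructs-resp-≈H q cT) (≤₃s-resp-≈H q p) f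
≤₃s-resp-≈H q [] = []
≤₃s-resp-≈H q (d ∷ ds) = ≤₃-resp-≈H (≈restrict _ q) d ∷ ≤₃s-resp-≈H q ds

fill-mono : ∀ {σ₁ σ₂ : List (Subset n × Tree n)} {P R} → (∀ {K S} → (K , S) ∈L σ₁ → (K , S) ∈L σ₂) → Fill σ₁ P R → Fill σ₂ P R
fill-monos : ∀ {σ₁ σ₂ : List (Subset n × Tree n)} {Ps Rs} → (∀ {K S} → (K , S) ∈L σ₁ → (K , S) ∈L σ₂) →
  Pointwise (Fill σ₁) Ps Rs → Pointwise (Fill σ₂) Ps Rs
fill-mono f (fillΩ m) = fillΩ (f m)
fill-mono f (fillNode ps) = fillNode (fill-monos f ps)
fill-monos f [] = []
fill-monos f (p ∷ ps) = fill-mono f p ∷ fill-monos f ps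

lookup-tree : List (Subset n × Tree n) → Subset n → Tree n
lookup-tree [] K = node ⊥ []
lookup-tree ((H , S) ∷ σ) K with H ≟S K
... | yes _ = S
... | no _ = lookup-tree σ K

lookup-tree-≡ : ∀ {σ : List (Subset n × Tree n)} {K S} → Unique (map proj₁ σ) → (K , S) ∈L σ → lookup-tree σ K ≡ S
lookup-tree-≡ {σ = (H , S) ∷ σ} {K} u m with H ≟S K | m
... | yes _ | here refl = refl
... | yes refl | there m' = ⊥-elim (unique-head u (∈-map⁺ proj₁ m'))
... | no ne | here refl = ⊥-elim (ne refl)
... | no _ | there m' = lookup-tree-≡ (unique-tail u) m'

Sound : Hyp n → List (Subset n) → List (Tree n) → List (Subset n × Tree n) → Set
Sound G Hs Ts σ = ∀ {K S'} → (K , S') ∈L σ →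
  Σ (Tree _) λ T → (K , T) ∈L zip Hs Ts × Construct (restrict G K) S' × S' ≤₃[ restrict G K ] T

-- S = ℙ[Ω_{Hᵢ} ← σ(Hᵢ)] for a partial construct ℙ spanning X and a sound
-- substitution σ with exactly one entry per component Hᵢ of 𝐇 ∖ X
record Decomposition (G : Hyp n) (X : Subset n) (Hs : List (Subset n)) (Ts : List (Tree n)) (S : Tree n) : Set where
  field
    P : PTree n
    σ : List (Subset n × Tree n)
    partial : PartialConstruct G P
    spans : labels P ≡ X
    fill : Fill σ P S
    keys-unique : Unique (map proj₁ σ)
    sound : Sound G Hs Ts σ
    complete : ∀ {K} → K ∈L Hs → K ∈L map proj₁ σ

record ChildDecomposition (G : Hyp n) (X : Subset n) (Hs : List (Subset n)) (Ts : List (Tree n)) (K : Subset n) (S : Tree n) : Set where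
  field
    P : PTree n
    σ : List (Subset n × Tree n)
    partial : PartialConstruct (restrict G K) P
    spans : labels P ≡ K ∩ X
    fill : Fill σ P S
    keys-unique : Unique (map proj₁ σ)
    keys⊆ : ∀ {K' S'} → (K' , S') ∈L σ → K' ⊆ K
    sound : Sound G Hs Ts σ
    complete : ∀ {H} → H ∈L Hs → H ⊆ K → H ∈L map proj₁ σ

record ChildrenDecomposition (G : Hyp n) (X : Subset n) (Hs : List (Subset n)) (Ts : List (Tree n))
                             (Ks : List (Subset n)) (Ss : List (Tree n)) : Set where
  field
    Ps : List (PTree n)
    σ : List (Subset n × Tree n)
    partials : Pointwise (λ K P → PartialConstruct (restrict G K) P) Ks Ps
    spans : Pointwise (λ K P → labels P ≡ K ∩ X) Ks Ps
    fills : Pointwise (Fill σ) Ps Ss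
    keys-unique : Unique (map proj₁ σ)
    keys⊆ : ∀ {K' S'} → (K' , S') ∈L σ → Σ _ λ K → K ∈L Ks × K' ⊆ K
    sound : Sound G Hs Ts σ
    complete : ∀ {H K} → H ∈L Hs → K ∈L Ks → H ⊆ K → H ∈L map proj₁ σ

children-[] : ∀ {G : Hyp n} {X Hs Ts} → ChildrenDecomposition G X Hs Ts [] []
children-[] = record { Ps = [] ; σ = [] ; partials = [] ; spans = [] ; fills = [] ; keys-unique = []
                     ; keys⊆ = λ () ; sound = λ () ; complete = λ _ () }

-- decompositions of distinct components combine: their substitutions have
-- disjoint keys, since keys lie in their (disjoint) components
children-∷ : ∀ {G : Hyp n} {Y X Hs Ts K Ks S Ss} → Leads G X Hs →
  (∀ {K'} → K' ∈L K ∷ Ks → IsComponent (restrict G (V G ─ Y)) K') → Unique (K ∷ Ks) →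
  ChildDecomposition G X Hs Ts K S → ChildrenDecomposition G X Hs Ts Ks Ss → ChildrenDecomposition G X Hs Ts (K ∷ Ks) (S ∷ Ss)
children-∷ {G = G} {Y} {X} {Hs} {Ts} {K} {Ks} lX cK uK h w = record
  { Ps = H.P ∷ W.Ps
  ; σ = H.σ ++ W.σ
  ; partials = H.partial ∷ W.partials
  ; spans = H.spans ∷ W.spans
  ; fills = fill-mono ∈-++⁺ˡ H.fill ∷ fill-monos (∈-++⁺ʳ H.σ) W.fills
  ; keys-unique = subst Unique (sym (map-++ proj₁ H.σ W.σ)) (UP.++⁺ H.keys-unique W.keys-unique disjoint)
  ; keys⊆ = keys⊆
  ; sound = sound
  ; complete = complete
  }
  where
  module H = ChildDecomposition h
  module W = ChildrenDecomposition w
  sound : Sound G Hs Ts (H.σ ++ W.σ)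
  sound m = [ H.sound , W.sound ] (∈-++⁻ H.σ m)
  keys⊆ : ∀ {K' S'} → (K' , S') ∈L H.σ ++ W.σ → Σ _ λ K'' → K'' ∈L K ∷ Ks × K' ⊆ K''
  keys⊆ m with ∈-++⁻ H.σ m
  ... | inj₁ m₁ = K , here refl , H.keys⊆ m₁
  ... | inj₂ m₂ = let (K'' , a , b) = W.keys⊆ m₂ in K'' , there a , b
  disjoint : ∀ {v} → ¬ (v ∈L map proj₁ H.σ × v ∈L map proj₁ W.σ)
  disjoint (m₁ , m₂) =
    let (_ , m₁') = key∈ m₁ ; (_ , m₂') = key∈ m₂
        (K' , mK' , vK') = W.keys⊆ m₂'
        (x , ix) = LeadsFacts.ne lX (zip∈ˡ (proj₁ (proj₂ (H.sound m₁'))))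
        K≡K' = component-overlap⇒≡ (restrict G (V G ─ Y)) _ _ (cK (here refl)) (cK (there mK')) (x , ∈∩⁺ (H.keys⊆ m₁' ix) (vK' ix))
    in unique-head uK (subst (_∈L Ks) (sym K≡K') mK')
  complete : ∀ {H' K'} → H' ∈L Hs → K' ∈L K ∷ Ks → H' ⊆ K' → H' ∈L map proj₁ (H.σ ++ W.σ)
  complete mH (here refl) s = subst (_ ∈L_) (sym (map-++ proj₁ H.σ W.σ)) (∈-++⁺ˡ (H.complete mH s))
  complete mH (there mK) s = subst (_ ∈L_) (sym (map-++ proj₁ H.σ W.σ)) (∈-++⁺ʳ (map proj₁ H.σ) (W.complete mH mK s))

-- For a step Y(S₁,…) ≤₂ X(…), the
-- partial construct is Y(ℙ₁,…), where ℙⱼ = Ω_{Kⱼ} if Kⱼ avoids X (then Kⱼ is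
-- some Hᵢ and Sⱼ ≤₂ Tᵢ, so Sⱼ ≤₃ Tᵢ) and otherwise decomposes Sⱼ along its target.
-- The right-hand side is taken up to ≡ so that all recursive calls are
-- on sub-derivations (the target of a child is only propositionally a node).
≤₂⇒decomposition : ∀ {G : Hyp n} {S T' X Hs Ts} → S ≤₂[ G ] T' → T' ≡ node X Ts → Nonempty X → X ⊆ V G →
  Leads G X Hs → Pointwise (ConstructOn G) Hs Ts → Decomposition G X Hs Ts S
≤₂⇒decomposition-children : ∀ {G : Hyp n} {Y X Hs Ts Ks₀ Ss₀} → Y ⊆ X → X ⊆ V G → Leads G X Hs →
  Pointwise (ConstructOn G) Hs Ts → (∀ {K} → K ∈L Ks₀ → IsComponent (restrict G (V G ─ Y)) K) → Unique Ks₀ →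
  Pointwise (ConstructOn G) Ks₀ Ss₀ → Below₂ G X Hs Ts Ks₀ Ss₀ → ChildrenDecomposition G X Hs Ts Ks₀ Ss₀
≤₂⇒decomposition-child : ∀ {G : Hyp n} {Y X Hs Ts K S} → Y ⊆ X → X ⊆ V G → Leads G X Hs → Pointwise (ConstructOn G) Hs Ts →
  IsComponent (restrict G (V G ─ Y)) K → Construct (restrict G K) S →
  S ≤₂[ restrict G K ] target X Hs Ts K → ChildDecomposition G X Hs Ts K S
≤₂⇒≤₃′ : ∀ {G : Hyp n} {S T' T} → S ≤₂[ G ] T' → T' ≡ T → Construct G T → S ≤₃[ G ] T

≤₂⇒decomposition {G = G} base₂ refl nX xV lX [] =
  record { P = pnode (V G) [] ; σ = [] ; partial = pwhole ; spans = ∪-identityʳ (V G) ; fill = fillNode []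
         ; keys-unique = [] ; sound = λ () ; complete = λ () }
≤₂⇒decomposition {G = G} {X = X} {Hs = Hs} (step₂ {Y = Y} {Ks = Ks} nY _ yx _ lY lX' cS cT' pS) refl nX xV lX cT
  with leads-unique lX lX' cT cT'
... | refl = record { P = pnode Y W.Ps ; σ = W.σ ; partial = proot nY (xV ∘ yx) lY W.partials ; spans = spans
                    ; fill = fillNode W.fills ; keys-unique = W.keys-unique ; sound = W.sound ; complete = complete }
  where
  module W = ChildrenDecomposition (≤₂⇒decomposition-children yx xV lX cT (LeadsFacts.comp lY) (LeadsFacts.uniq lY) cS pS)
  spans : Y ∪ labelsL W.Ps ≡ X
  spans = ⊆-antisym ⊆X X⊆
    where
    ⊆X : Y ∪ labelsL W.Ps ⊆ X
    ⊆X i with x∈p∪q⁻ Y (labelsL W.Ps) i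
    ... | inj₁ j = yx j
    ... | inj₂ j = let (P , mP , xP) = labelsL⁻ j ; (K , m) = pw∈ʳ W.spans mP in
                   p∩q⊆q K X (∈≡ (pw∈ W.spans m) xP)
    X⊆ : X ⊆ Y ∪ labelsL W.Ps
    X⊆ {x} i with x ∈? Y
    ... | yes j = p⊆p∪q _ j
    ... | no j = let (K , mK , xK) = LeadsFacts.coverY lY (xV i) j ; (P , m) = pw∈ˡ W.spans mK in
                 ∈∪ʳ Y (labelsL⁺ (zip∈ʳ m) (∈≡ (sym (pw∈ W.spans m)) (∈∩⁺ xK i)))
  -- every Hᵢ lies in some Kⱼ, whose decomposition covers it
  complete : ∀ {K} → K ∈L Hs → K ∈L map proj₁ W.σ
  complete {H} mH = let (K , mK , hk) = component-refines G Y X Ks H yx lY (LeadsFacts.comp lX mH) in W.complete mH mK hk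

≤₂⇒decomposition-children yx xV lX cT cK uK [] [] = children-[]
≤₂⇒decomposition-children yx xV lX cT cK uK (c ∷ cs) (d ∷ ds) =
  children-∷ lX cK uK (≤₂⇒decomposition-child yx xV lX cT (cK (here refl)) c d)
                      (≤₂⇒decomposition-children yx xV lX cT (cK ∘ there) (unique-tail uK) cs ds)

≤₂⇒decomposition-child {G = G} {Y} {X} {Hs} {Ts} {K} {S} yx xV lX cT cK c d with nonempty? (K ∩ X)
... | no ¬ne = record { P = Ω K ; σ = (K , S) ∷ [] ; partial = pΩ ; spans = sym (empty≡ (λ i → ¬ne (_ , i)))
                      ; fill = fillΩ (here refl) ; keys-unique = [] ∷ [] ; keys⊆ = keys⊆ ; sound = sound ; complete = complete }
  where
  mK = LeadsFacts.mem lX (component-shrink G Y X K yx cK (λ i j → ¬ne (_ , ∈∩⁺ i j)))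
  Tm = pw∈ˡ cT mK
  keys⊆ : ∀ {K' S'} → (K' , S') ∈L (K , S) ∷ [] → K' ⊆ K
  keys⊆ (here refl) = λ i → i
  sound : Sound G Hs Ts ((K , S) ∷ [])
  sound (here refl) = proj₁ Tm , proj₂ Tm , c , ≤₂⇒≤₃′ d (target-component lX (proj₂ Tm)) (pw∈ cT (proj₂ Tm))
  complete : ∀ {H} → H ∈L Hs → H ⊆ K → H ∈L K ∷ []
  complete mH hk = here (LeadsFacts.sub⇒eq lX mK mH hk)
... | yes ne = record { P = R.P ; σ = R.σ ; partial = R.partial ; spans = R.spans ; fill = R.fill
                      ; keys-unique = R.keys-unique ; keys⊆ = keys⊆ ; sound = sound ; complete = complete }
  where
  module R = Decomposition (≤₂⇒decomposition d (target-node Hs Ts ne) ne (p∩q⊆p K X) (leads-select G yx cK lX cT)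
                                                (select-constructs {G = G} {L = K} cT))
  keys⊆ : ∀ {K' S'} → (K' , S') ∈L R.σ → K' ⊆ K
  keys⊆ m = proj₂ (select-keys⁻ {L = K} {xs = Hs} {ys = Ts} (proj₁ (proj₂ (R.sound m))))
  sound : Sound G Hs Ts R.σ
  sound m = let (T , mT , c' , le) = R.sound m ; (mT' , k'k) = select-keys⁻ {L = K} {xs = Hs} {ys = Ts} mT in
    T , mT' , construct-resp-≈H (restrict-restrict G k'k) c' , ≤₃-resp-≈H (restrict-restrict G k'k) le
  complete : ∀ {H} → H ∈L Hs → H ⊆ K → H ∈L map proj₁ R.σ
  complete {H} mH hk = R.complete (from (select-keys∈ cT H) (mH , hk))

-- a decomposition is exactly the data of a ≤₃-step: the subtree substituted
-- for Ω_{Hᵢ} is σ(Hᵢ)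
decomposition⇒≤₃ : ∀ {G : Hyp n} {X Hs Ts S} → Nonempty X → Leads G X Hs → Pointwise (ConstructOn G) Hs Ts →
                   Decomposition G X Hs Ts S → S ≤₃[ G ] node X Ts
decomposition⇒≤₃ {G = G} {X} {Hs} {Ts} {S} nX lX cT D = step₃ nX (D.partial , D.spans) lX cS cT below fill
  where
  module D = Decomposition D
  Ss = map (lookup-tree D.σ) Hs
  value : ∀ {K} → K ∈L Hs → Σ _ λ S' → (K , S') ∈L D.σ × lookup-tree D.σ K ≡ S'
  value mH = let (S' , m) = key∈ (D.complete mH) in S' , m , lookup-tree-≡ D.keys-unique m
  cS : Pointwise (ConstructOn G) Hs Ss
  cS = pw-map-self (lookup-tree D.σ) λ mH →
    let (S' , m , eq) = value mH in subst (Construct _) (sym eq) (proj₁ (proj₂ (proj₂ (D.sound m))))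
  below-at : ∀ {K S₁ T₁} → (K , (S₁ , T₁)) ∈L zip Hs (zip Ss Ts) → S₁ ≤₃[ restrict G K ] T₁
  below-at {K} m =
    let (eS , mT) = zipmap∈ m ; (S' , mS , eq) = value (zip∈ˡ mT) ; (T' , mT' , _ , le) = D.sound mS
    in subst₂ (_≤₃[ restrict G K ]_) (Eq.trans (sym eq) (sym eS)) (unique-key (LeadsFacts.uniq lX) mT' mT) le
  below : Pointwise (λ K ST → proj₁ ST ≤₃[ restrict G K ] proj₂ ST) Hs (zip Ss Ts)
  below = pw-build (pw-skel {g = lookup-tree D.σ} cT) (λ {K} {ST} m → below-at {K} {proj₁ ST} {proj₂ ST} m)
  fill : Fill (zip Hs Ss) D.P S
  fill = fill-mono (λ {K} m → let (T , mT , _) = D.sound m in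
                      subst (λ Z → (K , Z) ∈L zip Hs Ss) (lookup-tree-≡ D.keys-unique m) (keyval (zip∈ˡ mT))) D.fill

≤₂⇒≤₃′ {T = node X Ts} d eq cT with construct-node⁻ cT
... | Hs , lX , cTs , nX , xV = decomposition⇒≤₃ nX lX cTs (≤₂⇒decomposition d eq nX xV lX cTs)

≤₂⇒≤₃ : ∀ {G : Hyp n} {S T} → S ≤₂[ G ] T → Construct G T → S ≤₃[ G ] T
≤₂⇒≤₃ d = ≤₂⇒≤₃′ d refl

-- The theorem: the three relations coincide

proposition1 : ∀ {n : ℕ} (H : Hyp n) → IsHypergraph H → Atomic H → Connected H →
    ∀ S T → Construct H S → Construct H T →
    ((S ≤[ H ] T) ⇔ (S ≤₂[ H ] T)) × ((S ≤₂[ H ] T) ⇔ (S ≤₃[ H ] T))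
proposition1 H _ _ _ S T _ cT =
  mk⇔ ≤⇒≤₂ (≤₃⇒≤ ∘ ≤₂→≤₃) , mk⇔ ≤₂→≤₃ (≤⇒≤₂ ∘ ≤₃⇒≤)
  where
  ≤₂→≤₃ : S ≤₂[ H ] T → S ≤₃[ H ] T
  ≤₂→≤₃ d = ≤₂⇒≤₃ d cT
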